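{- For every order function $g$ there exists an order function $h$ such that every $\mathrm{DNR}_g$ function computes an $\mathrm{SNPR}_h$ function.
   Context: Let $\varphi_e$ denote the $e$-th partial recursive function. A function $f:\omega\to\omega$ is $\mathrm{DNR}$ (diagonally non-recursive) if $f(n)\neq\varphi_n(n)$ for every $n$ such that $\varphi_n(n)$ is defined. A function $f:\omega\to\omega$ is strongly non-partial-recursive ($\mathrm{SNPR}$) if for every partial recursive function $\psi$, for all but finitely many $n$, if $\psi(n)$ is defined then $f(n)\neq\psi(n)$. An order function is a recursive, nondecreasing, unbounded function $h:\omega\to\omega$ with $h(0)\ge 2$. For a class $\mathrm{C}$ of functions $\omega\to\omega$ and an order function $h$, $\mathrm{C}_h$ denotes the subclass of members of $\mathrm{C}$ bounded by $h$ (i.e. $f(n)<h(n)$ for all $n$). "Computes" means Turing computes. -}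

module Defs where

open import Data.Nat using (ℕ; zero; suc; _+_; _∸_; _≤_; _<_; _≤ᵇ_)
open import Data.Nat.Properties using (_≟_)
open import Data.Product using (Σ; _×_; _,_; proj₁; proj₂)
open import Data.List using (List; []; _∷_; length)
open import Data.Maybe using (Maybe; just; nothing)
open import Data.Bool using (Bool; true; false; if_then_else_)
open import Relation.Binary.PropositionalEquality using (_≡_; _≢_)
open import Relation.Nullary using (yes; no)

-- Model of computation: register (Minsky) machines with an oracle.
-- Programs are lists of instructions; the machine halts when the
-- program counter leaves the program.  Input in register 0 (all other
-- registers 0), output read from register 0 on halting.

data Instr : Set where
  inc   : ℕ → Instr
  dec   : ℕ → ℕ → Instr      -- if R r = 0 then pc := j else (R r := R r - 1 ; pc := pc + 1)
  query : ℕ → Instr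

Program : Set
Program = List Instr

-- Cantor-style unpairing ℕ → ℕ × ℕ (a bijection), by structural recursion.
unpair : ℕ → ℕ × ℕ
unpair zero = 0 , 0
unpair (suc m) with unpair m
... | a , zero  = 0 , suc a
... | a , suc b = suc a , b

decodeInstr : ℕ → Instr
decodeInstr k with unpair k
... | 0 , r = inc r
... | 1 , rj = dec (proj₁ (unpair rj)) (proj₂ (unpair rj))
... | suc (suc _) , r = query r

-- decoding of programs; the first argument is fuel (n suffices for n)
decodeF : ℕ → ℕ → Program
decodeF zero    _       = []
decodeF (suc _) zero    = []
decodeF (suc f) (suc m) = decodeInstr (proj₁ (unpair m)) ∷ decodeF f (proj₂ (unpair m))

-- the e-th program (Gödel numbering, surjective onto Program)
decode : ℕ → Program
decode e = decodeF e e

Registers : Set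
Registers = ℕ → ℕ

update : Registers → ℕ → ℕ → Registers
update R r v i with i ≟ r
... | yes _ = v
... | no  _ = R i

record Config : Set where
  constructor cfg
  field
    pc   : ℕ
    regs : Registers
open Config public

fetch : Program → ℕ → Maybe Instr
fetch []       _       = nothing
fetch (i ∷ _)  zero    = just i
fetch (_ ∷ is) (suc n) = fetch is n

step : (ℕ → ℕ) → Program → Config → Config
step O p (cfg n R) with fetch p n
... | nothing          = cfg n R
... | just (inc r)     = cfg (suc n) (update R r (suc (R r)))
... | just (dec r j)   with R r
...   | zero  = cfg j R
...   | suc v = cfg (suc n) (update R r v)
step O p (cfg n R) | just (query r) = cfg (suc n) (update R r (O (R r)))

run : (ℕ → ℕ) → Program → ℕ → Config → Config
run O p zero    c = c
run O p (suc t) c = run O p t (step O p c)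

Halted : Program → Config → Set
Halted p c = length p ≤ pc c

initial : ℕ → Config
initial x = cfg 0 (λ i → if i ≤ᵇ 0 then x else 0)

Conv : (ℕ → ℕ) → ℕ → ℕ → ℕ → Set
Conv O e x y = Σ ℕ λ t → Halted (decode e) (run O (decode e) t (initial x))
                       × regs (run O (decode e) t (initial x)) 0 ≡ y

-- φ_e(x) ↓= y  (the e-th partial recursive function; oracle-free = constant-0 oracle)
φ : ℕ → ℕ → ℕ → Set
φ e x y = Conv (λ _ → 0) e x y

Computes : (ℕ → ℕ) → (ℕ → ℕ) → Set
Computes f F = Σ ℕ λ e → ∀ n → Conv f e n (F n)

Recursive : (ℕ → ℕ) → Set
Recursive h = Σ ℕ λ e → ∀ n → φ e n (h n)

OrderFunction : (ℕ → ℕ) → Set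
OrderFunction h = Recursive h
                × (∀ m n → m ≤ n → h m ≤ h n)
                × (∀ k → Σ ℕ λ n → k ≤ h n)
                × 2 ≤ h 0

BoundedBy : (ℕ → ℕ) → (ℕ → ℕ) → Set
BoundedBy h f = ∀ n → f n < h n

DNR : (ℕ → ℕ) → Set
DNR f = ∀ n y → φ n n y → f n ≢ y

-- every partial recursive ψ is some φ_e
SNPR : (ℕ → ℕ) → Set
SNPR f = ∀ e → Σ ℕ λ N → ∀ n → N ≤ n → ∀ y → φ e n y → f n ≢ y

DNRb : (ℕ → ℕ) → (ℕ → ℕ) → Set
DNRb h f = DNR f × BoundedBy h f

SNPRb : (ℕ → ℕ) → (ℕ → ℕ) → Set
SNPRb h f = SNPR f × BoundedBy h f

-- Fix f ∈ DNR_g.  Let k(n, j) be an index of a copy of the j-th program that records n and j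
-- in a harmless extra first instruction, and let F(n) code the tuple f(k(n,0)), …, f(k(n,n)).
-- F is computable from f, and F(n) is bounded by the code of the tuple of n + 1 copies of
-- g(k(n,n)) ∸ 1, a recursive order function of n because g is one.  Given e, let b be an index of
-- the program that on input k(n, j) outputs the j-th entry of φ_e(n).  If φ_e(n) = F(n) with
-- n ≥ b, then φ_{k(n,b)}(k(n,b)) = f(k(n,b)), against f ∈ DNR; so F is SNPR.

module Submission where

open import Defs
open import Data.Nat using (ℕ; zero; suc; _+_; _∸_; _*_; _≤_; _<_; z≤n; s≤s; s≤s⁻¹; pred; _⊔_; _⊓_)
open import Data.Nat.Properties
open import Data.Nat.Tactic.RingSolver using (solve-∀)
open import Data.Product using (Σ; _×_; _,_; proj₁; proj₂)
open import Data.Sum using (_⊎_; inj₁; inj₂)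
open import Data.List using ([]; _∷_; length; _++_; map)
open import Data.List.Properties using (length-++; length-map)
open import Data.Maybe using (just; nothing)
import Data.Maybe as Maybe
open import Data.Fin using (Fin; toℕ; #_)
open import Data.Fin.Properties using (toℕ<n)
open import Data.Empty using (⊥-elim)
open import Function using (_∘′_)
open import Relation.Binary.PropositionalEquality
open import Relation.Nullary using (yes; no)
open import Relation.Nullary.Decidable using (True; toWitness; from-yes)

-- Register machines

update-≡ : ∀ R r v → update R r v r ≡ v
update-≡ R r v with r ≟ r
... | yes _ = refl
... | no r≢r = ⊥-elim (r≢r refl)

update-≢ : ∀ R r v i → i ≢ r → update R r v i ≡ R i
update-≢ R r v i i≢r with i ≟ r
... | yes i≡r = ⊥-elim (i≢r i≡r)
... | no _ = refl

run-+ : ∀ O p a b c → run O p (a + b) c ≡ run O p b (run O p a c)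
run-+ O p zero b c = refl
run-+ O p (suc a) b c = run-+ O p a b (step O p c)

fetch-≥length : ∀ (p : Program) n → length p ≤ n → fetch p n ≡ nothing
fetch-≥length [] n _ = refl
fetch-≥length (x ∷ p) (suc n) (s≤s le) = fetch-≥length p n le

fetch-<length : ∀ (p : Program) n → n < length p → Σ Instr λ ins → fetch p n ≡ just ins
fetch-<length (x ∷ p) zero lt = x , refl
fetch-<length (x ∷ p) (suc n) (s≤s lt) = fetch-<length p n lt

fetch-map : ∀ (f : Instr → Instr) p n → fetch (map f p) n ≡ Maybe.map f (fetch p n)
fetch-map f [] n = refl
fetch-map f (x ∷ p) zero = refl
fetch-map f (x ∷ p) (suc n) = fetch-map f p n

fetch-++ˡ : ∀ (xs ys : Program) i {ins} → fetch xs i ≡ just ins → fetch (xs ++ ys) i ≡ just ins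
fetch-++ˡ (x ∷ xs) ys zero eq = eq
fetch-++ˡ (x ∷ xs) ys (suc i) eq = fetch-++ˡ xs ys i eq

fetch-++ʳ : ∀ (xs ys : Program) i → fetch (xs ++ ys) (length xs + i) ≡ fetch ys i
fetch-++ʳ [] ys i = refl
fetch-++ʳ (x ∷ xs) ys i = fetch-++ʳ xs ys i

stepInstr : (ℕ → ℕ) → Instr → ℕ → Registers → Config
stepInstr O (inc r) n R = cfg (suc n) (update R r (suc (R r)))
stepInstr O (dec r j) n R with R r
... | zero = cfg j R
... | suc v = cfg (suc n) (update R r v)
stepInstr O (query r) n R = cfg (suc n) (update R r (O (R r)))

stepInstr-dec-zero : ∀ O r j n R → R r ≡ 0 → stepInstr O (dec r j) n R ≡ cfg j R
stepInstr-dec-zero O r j n R e rewrite e = refl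

stepInstr-dec-suc : ∀ O r j n R v → R r ≡ suc v → stepInstr O (dec r j) n R ≡ cfg (suc n) (update R r v)
stepInstr-dec-suc O r j n R v e rewrite e = refl

step-fetch : ∀ O P n R ins → fetch P n ≡ just ins → step O P (cfg n R) ≡ stepInstr O ins n R
step-fetch O P n R (inc r) eq rewrite eq = refl
step-fetch O P n R (query r) eq rewrite eq = refl
step-fetch O P n R (dec r j) eq rewrite eq with R r
... | zero = refl
... | suc v = refl

step-halted : ∀ O P n R → fetch P n ≡ nothing → step O P (cfg n R) ≡ cfg n R
step-halted O P n R eq rewrite eq = refl

Halts : (ℕ → ℕ) → Program → ℕ → ℕ → Set
Halts O p x y = Σ ℕ λ t → Halted p (run O p t (initial x)) × regs (run O p t (initial x)) 0 ≡ y

Embeds : Program → ℕ → Program → Set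
Embeds P o code = ∀ i {ins} → fetch code i ≡ just ins → fetch P (o + i) ≡ just ins

embeds-++ˡ : ∀ P o xs ys → Embeds P o (xs ++ ys) → Embeds P o xs
embeds-++ˡ P o xs ys e i eq = e i (fetch-++ˡ xs ys i eq)

embeds-++ʳ : ∀ P o xs ys → Embeds P o (xs ++ ys) → Embeds P (o + length xs) ys
embeds-++ʳ P o xs ys e i {ins} eq =
  subst (λ k → fetch P k ≡ just ins) (sym (+-assoc o (length xs) i))
        (e (length xs + i) (trans (fetch-++ʳ xs ys i) eq))

embeds-∷ : ∀ P o x xs → Embeds P o (x ∷ xs) → Embeds P (suc o) xs
embeds-∷ P o x xs e i {ins} eq = subst (λ k → fetch P k ≡ just ins) (+-suc o i) (e (suc i) eq)

embeds-at : ∀ P o code k {ins} → Embeds P o code → fetch code k ≡ just ins → fetch P (k + o) ≡ just ins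
embeds-at P o code k {ins} e eq = subst (λ k → fetch P k ≡ just ins) (+-comm o k) (e k eq)

embeds-head : ∀ P o x xs → Embeds P o (x ∷ xs) → fetch P o ≡ just x
embeds-head P o x xs e = embeds-at P o (x ∷ xs) 0 e refl

Reaches : (ℕ → ℕ) → Program → ℕ → Registers → ℕ → (Registers → Set) → Set
Reaches O P o S o' Q = Σ ℕ λ t → pc (run O P t (cfg o S)) ≡ o' × Q (regs (run O P t (cfg o S)))

reach-refl : ∀ {O P o S Q} → Q S → Reaches O P o S o Q
reach-refl q = 0 , refl , q

reach-trans : ∀ {O P o S o1 o2 Q1 Q2} → Reaches O P o S o1 Q1 →
  (∀ S1 → Q1 S1 → Reaches O P o1 S1 o2 Q2) → Reaches O P o S o2 Q2
reach-trans {O} {P} {o} {S} {o1} {o2} {Q1} {Q2} (t , e1 , q1) k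
  with run O P t (cfg o S) in eqr
... | cfg pc1 S1 with k S1 q1
...   | t2 , e2 , q2 rewrite e1 =
  t + t2 , subst (λ C → pc C ≡ o2 × Q2 (regs C)) (sym (trans (run-+ O P t t2 (cfg o S)) (cong (run O P t2) eqr))) (e2 , q2)

reach-start-≡ : ∀ {O P o o' S o'' Q} → o ≡ o' → Reaches O P o S o'' Q → Reaches O P o' S o'' Q
reach-start-≡ refl r = r

reach-end-≡ : ∀ {O P o S o' o'' Q} → o' ≡ o'' → Reaches O P o S o' Q → Reaches O P o S o'' Q
reach-end-≡ refl r = r

reach-step : ∀ {O P o S o' Q} → (ins : Instr) → fetch P o ≡ just ins →
  Reaches O P (pc (stepInstr O ins o S)) (regs (stepInstr O ins o S)) o' Q → Reaches O P o S o' Q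
reach-step {O} {P} {o} {S} ins eq (t , e , q) rewrite sym (step-fetch O P o S ins eq) = suc t , e , q

reach-dec-zero : ∀ {O P o S o' Q} r j → fetch P o ≡ just (dec r j) → S r ≡ 0 →
  Reaches O P j S o' Q → Reaches O P o S o' Q
reach-dec-zero {O} {P} {o} {S} {o'} {Q} r j eq z k =
  reach-step {Q = Q} (dec r j) eq (subst (λ C → Reaches O P (pc C) (regs C) o' Q) (sym (stepInstr-dec-zero O r j o S z)) k)

reach-dec-suc : ∀ {O P o S o' Q} r j v → fetch P o ≡ just (dec r j) → S r ≡ suc v →
  Reaches O P (suc o) (update S r v) o' Q → Reaches O P o S o' Q
reach-dec-suc {O} {P} {o} {S} {o'} {Q} r j v eq s k =
  reach-step {Q = Q} (dec r j) eq (subst (λ C → Reaches O P (pc C) (regs C) o' Q) (sym (stepInstr-dec-suc O r j o S v s)) k)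

reach-dec : ∀ {O P o S o' Q} r j → fetch P o ≡ just (dec r j) →
  (S r ≡ 0 → Reaches O P j S o' Q) →
  (∀ v → S r ≡ suc v → Reaches O P (suc o) (update S r v) o' Q) → Reaches O P o S o' Q
reach-dec {S = S} {Q = Q} r j eq kz ks with S r in e
... | zero = reach-dec-zero {Q = Q} r j eq e (kz refl)
... | suc v = reach-dec-suc {Q = Q} r j v eq e (ks v refl)

-- A structured language compiled to register machines

-- Structured programs use registers 0–19.  The compiled code keeps register 20 at 0 and
-- uses `dec 20 j` as an unconditional jump; a called program runs in registers 21, 22, …
Reg : Set
Reg = Fin 20

data Cmd : Set where
  SKIP : Cmd
  INC DEC QRY : Reg → Cmd
  SEQ : Cmd → Cmd → Cmd
  IFNZ LOOP : Reg → Cmd → Cmd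
  CALL : Program → Reg → Cmd

upd : Registers → Reg → ℕ → Registers
upd R r v = update R (toℕ r) v

val : Registers → Reg → ℕ
val R r = R (toℕ r)

-- IFNZ r c and LOOP r c decrement r before running the body.
data Exec (O : ℕ → ℕ) : Cmd → Registers → Registers → Set where
  eSKIP : ∀ {R} → Exec O SKIP R R
  eINC : ∀ {r R} → Exec O (INC r) R (upd R r (suc (val R r)))
  eDEC : ∀ {r R} → Exec O (DEC r) R (upd R r (pred (val R r)))
  eQRY : ∀ {r R} → Exec O (QRY r) R (upd R r (O (val R r)))
  eSEQ : ∀ {c d R R1 R2} → Exec O c R R1 → Exec O d R1 R2 → Exec O (SEQ c d) R R2
  eIF0 : ∀ {r c R} → val R r ≡ 0 → Exec O (IFNZ r c) R R
  eIFS : ∀ {r c R R' v} → val R r ≡ suc v → Exec O c (upd R r v) R' → Exec O (IFNZ r c) R R'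
  eL0 : ∀ {r c R} → val R r ≡ 0 → Exec O (LOOP r c) R R
  eLS : ∀ {r c R R1 R2 v} → val R r ≡ suc v → Exec O c (upd R r v) R1 → Exec O (LOOP r c) R1 R2 → Exec O (LOOP r c) R R2
  eCALL : ∀ {p a R y} → Halts O p (val R a) y → Exec O (CALL p a) R (upd R a y)

instrReg : Instr → ℕ
instrReg (inc r) = r
instrReg (dec r j) = r
instrReg (query r) = r

maxReg : Program → ℕ
maxReg [] = 0
maxReg (i ∷ p) = instrReg i ⊔ maxReg p

-- Jumps past the end of a program of length L are clamped to L, its exit point.
relocate : ℕ → ℕ → Instr → Instr
relocate off L (inc r) = inc (21 + r)
relocate off L (dec r j) = dec (21 + r) (off + (j ⊓ L))
relocate off L (query r) = query (21 + r)

clearBlock : ℕ → ℕ → Program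
clearBlock off zero = []
clearBlock off (suc m) = dec (21 + m) (off + 2) ∷ dec 20 off ∷ clearBlock (off + 2) m

transfer : ℕ → ℕ → ℕ → Program
transfer off src dst = dec src (off + 3) ∷ inc dst ∷ dec 20 off ∷ []

callSize : Program → ℕ
callSize p = 2 * suc (maxReg p) + (3 + (length p + 3))

compileCall : ℕ → Program → ℕ → Program
compileCall o p a =
  clearBlock o (suc (maxReg p)) ++
  (transfer (o + 2 * suc (maxReg p)) a 21 ++
  (map (relocate (o + 2 * suc (maxReg p) + 3) (length p)) p ++
  transfer (o + 2 * suc (maxReg p) + 3 + length p) 21 a))

size : Cmd → ℕ
size SKIP = 0
size (INC r) = 1
size (DEC r) = 1
size (QRY r) = 1
size (SEQ c d) = size c + size d
size (IFNZ r c) = suc (size c)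
size (LOOP r c) = suc (suc (size c))
size (CALL p a) = callSize p

-- Jump targets are absolute, so c is compiled for the address o where it is placed.
compile : ℕ → Cmd → Program
compile o SKIP = []
compile o (INC r) = inc (toℕ r) ∷ []
compile o (DEC r) = dec (toℕ r) (suc o) ∷ []
compile o (QRY r) = query (toℕ r) ∷ []
compile o (SEQ c d) = compile o c ++ compile (o + size c) d
compile o (IFNZ r c) = dec (toℕ r) (o + suc (size c)) ∷ compile (suc o) c
compile o (LOOP r c) = dec (toℕ r) (o + suc (suc (size c))) ∷ (compile (suc o) c ++ (dec 20 o ∷ []))
compile o (CALL p a) = compileCall o p (toℕ a)

length-clearBlock : ∀ o m → length (clearBlock o m) ≡ 2 * m
length-clearBlock o zero = refl
length-clearBlock o (suc m) = trans (cong (λ x → suc (suc x)) (length-clearBlock (o + 2) m)) (sym (*-distribˡ-+ 2 1 m))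

length-compileCall : ∀ o p a → length (compileCall o p a) ≡ callSize p
length-compileCall o p a = begin
  length (C ++ (T₁ ++ (M ++ T₂)))                          ≡⟨ length-++ C {T₁ ++ (M ++ T₂)} ⟩
  length C + length (T₁ ++ (M ++ T₂))                      ≡⟨ cong (length C +_) (length-++ T₁ {M ++ T₂}) ⟩
  length C + (3 + length (M ++ T₂))                        ≡⟨ cong (λ k → length C + (3 + k)) (length-++ M {T₂}) ⟩
  length C + (3 + (length M + 3))                          ≡⟨ cong₂ (λ k l → k + (3 + (l + 3))) (length-clearBlock o (suc (maxReg p))) (length-map _ p) ⟩
  callSize p                                               ∎
  where
  open ≡-Reasoning
  C = clearBlock o (suc (maxReg p))
  T₁ = transfer (o + 2 * suc (maxReg p)) a 21
  M = map (relocate (o + 2 * suc (maxReg p) + 3) (length p)) p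
  T₂ = transfer (o + 2 * suc (maxReg p) + 3 + length p) 21 a

length-compile : ∀ o c → length (compile o c) ≡ size c
length-compile o SKIP = refl
length-compile o (INC r) = refl
length-compile o (DEC r) = refl
length-compile o (QRY r) = refl
length-compile o (SEQ c d) = trans (length-++ (compile o c)) (cong₂ _+_ (length-compile o c) (length-compile (o + size c) d))
length-compile o (IFNZ r c) = cong suc (length-compile (suc o) c)
length-compile o (LOOP r c) = cong suc (trans (length-++ (compile (suc o) c)) (trans (cong (_+ 1) (length-compile (suc o) c)) (+-comm (size c) 1)))
length-compile o (CALL p a) = length-compileCall o p (toℕ a)

record Represents (R S : Registers) : Set where
  constructor represents
  field
    agree : ∀ (i : Reg) → S (toℕ i) ≡ val R i
    zero-20 : S 20 ≡ 0
open Represents public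

20≢toℕ : ∀ (r : Reg) → 20 ≢ toℕ r
20≢toℕ r eq = <-irrefl (sym eq) (toℕ<n r)

represents-upd : ∀ {R S} (r : Reg) v → Represents R S → Represents (upd R r v) (update S (toℕ r) v)
represents-upd {R} {S} r v (represents g z) = represents agree′ (trans (update-≢ S (toℕ r) v 20 (20≢toℕ r)) z)
  where
  agree′ : ∀ (i : Reg) → update S (toℕ r) v (toℕ i) ≡ update R (toℕ r) v (toℕ i)
  agree′ i with toℕ i ≟ toℕ r
  ... | yes _ = refl
  ... | no _ = g i

represents-dec-zero : ∀ {R S} (r : Reg) → Represents R S → S (toℕ r) ≡ 0 → Represents (upd R r (pred (val R r))) S
represents-dec-zero {R} {S} r (represents g z) s0 = represents agree′ z
  where
  agree′ : ∀ (i : Reg) → S (toℕ i) ≡ update R (toℕ r) (pred (R (toℕ r))) (toℕ i)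
  agree′ i with toℕ i ≟ toℕ r
  ... | yes e = trans (cong S e) (trans s0 (cong pred (trans (sym s0) (g r))))
  ... | no _ = g i

Transferred : ℕ → ℕ → Registers → Registers → Set
Transferred src dst S S' = S' src ≡ 0 × S' dst ≡ S dst + S src × (∀ i → i ≢ src → i ≢ dst → S' i ≡ S i)

transfer-reaches : ∀ {O P} off src dst → Embeds P off (transfer off src dst) →
  src ≢ dst → src ≢ 20 → dst ≢ 20 → ∀ S → S 20 ≡ 0 →
  Reaches O P off S (off + 3) (Transferred src dst S)
transfer-reaches {O} {P} off src dst e s≢d s≢20 d≢20 S z = go (S src) S refl z
  where
  code = transfer off src dst
  go : ∀ v S → S src ≡ v → S 20 ≡ 0 → Reaches O P off S (off + 3) (Transferred src dst S)
  go zero S sv z =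
    reach-dec-zero {Q = Transferred src dst S} src (off + 3) (embeds-at P off code 0 e refl) sv
      (reach-refl {Q = Transferred src dst S} (sv , sym (trans (cong (S dst +_) sv) (+-identityʳ _)) , λ i _ _ → refl))
  go (suc v) S sv z =
    reach-dec-suc {Q = Transferred src dst S} src (off + 3) v (embeds-at P off code 0 e refl) sv
      (reach-step {Q = Transferred src dst S} (inc dst) (embeds-at P off code 1 e refl)
        (reach-dec-zero {Q = Transferred src dst S} 20 off (embeds-at P off code 2 e refl) S₂-20
          (reach-trans {Q1 = Transferred src dst S₂} {Q2 = Transferred src dst S} (go v S₂ S₂-src S₂-20)
            (λ S' (s , d , rest) → reach-refl {Q = Transferred src dst S}
               (s , sum S' d , λ i i≢s i≢d → trans (rest i i≢s i≢d) (trans (update-≢ _ dst _ i i≢d) (update-≢ S src v i i≢s)))))))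
    where
    S₁ = update S src v
    S₂ = update S₁ dst (suc (S₁ dst))
    S₂-src : S₂ src ≡ v
    S₂-src = trans (update-≢ S₁ dst _ src s≢d) (update-≡ S src v)
    S₂-20 : S₂ 20 ≡ 0
    S₂-20 = trans (update-≢ S₁ dst _ 20 (λ x → d≢20 (sym x))) (trans (update-≢ S src v 20 (λ x → s≢20 (sym x))) z)
    sum : ∀ S' → S' dst ≡ S₂ dst + S₂ src → S' dst ≡ S dst + S src
    sum S' d = trans d (trans (cong₂ _+_ (trans (update-≡ S₁ dst _) (cong suc (update-≢ S src v dst (λ x → s≢d (sym x))))) S₂-src)
      (trans (sym (+-suc (S dst) v)) (cong (S dst +_) (sym sv))))

Assigned : ℕ → ℕ → Registers → Registers → Set
Assigned q v S S' = S' q ≡ v × (∀ i → i ≢ q → S' i ≡ S i)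

clear-reaches : ∀ {O P} off q → Embeds P off (dec q (off + 2) ∷ dec 20 off ∷ []) → q ≢ 20 →
  ∀ S → S 20 ≡ 0 → Reaches O P off S (off + 2) (Assigned q 0 S)
clear-reaches {O} {P} off q e q≢20 S z = go (S q) S refl z
  where
  C = dec q (off + 2) ∷ dec 20 off ∷ []
  go : ∀ v S → S q ≡ v → S 20 ≡ 0 → Reaches O P off S (off + 2) (Assigned q 0 S)
  go zero S sv z =
    reach-dec-zero {Q = Assigned q 0 S} q (off + 2) (embeds-at P off C 0 e refl) sv (reach-refl {Q = Assigned q 0 S} (sv , λ i _ → refl))
  go (suc v) S sv z =
    reach-dec-suc {Q = Assigned q 0 S} q (off + 2) v (embeds-at P off C 0 e refl) sv
      (reach-dec-zero {Q = Assigned q 0 S} 20 off (embeds-at P off C 1 e refl) S₁-20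
        (reach-trans {Q1 = Assigned q 0 S₁} {Q2 = Assigned q 0 S} (go v S₁ (update-≡ S q v) S₁-20)
          (λ S' (a , b) → reach-refl {Q = Assigned q 0 S} (a , λ i i≢q → trans (b i i≢q) (update-≢ S q v i i≢q)))))
    where
    S₁ = update S q v
    S₁-20 : S₁ 20 ≡ 0
    S₁-20 = trans (update-≢ S q v 20 (λ x → q≢20 (sym x))) z

BlockZeroed : ℕ → Registers → Registers → Set
BlockZeroed m S S' = (∀ q → q < m → S' (21 + q) ≡ 0) × (∀ i → (i < 21 ⊎ 21 + m ≤ i) → S' i ≡ S i)

clearBlock-reaches : ∀ {O P} off m → Embeds P off (clearBlock off m) → ∀ S → S 20 ≡ 0 →
  Reaches O P off S (off + 2 * m) (BlockZeroed m S)
clearBlock-reaches {O} {P} off zero e S z =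
  reach-end-≡ {Q = BlockZeroed 0 S} (sym (+-identityʳ off)) (reach-refl {Q = BlockZeroed 0 S} ((λ q ()) , λ i _ → refl))
clearBlock-reaches {O} {P} off (suc m) e S z =
  reach-trans {Q1 = Assigned (21 + m) 0 S} {Q2 = BlockZeroed (suc m) S}
    (clear-reaches off (21 + m) (embeds-++ˡ P off C (clearBlock (off + 2) m) e) (λ ()) S z)
    (λ S₁ (a , b) → reach-end-≡ {Q = BlockZeroed (suc m) S} (trans (+-assoc off 2 (2 * m)) (cong (off +_) (sym (*-suc 2 m))))
       (reach-trans {Q1 = BlockZeroed m S₁} {Q2 = BlockZeroed (suc m) S}
         (clearBlock-reaches (off + 2) m (embeds-++ʳ P off C (clearBlock (off + 2) m) e) S₁ (trans (b 20 (λ ())) z))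
         (λ S' (c , d) → reach-refl {Q = BlockZeroed (suc m) S} (zeroed S₁ a S' c d , kept S₁ b S' d))))
  where
  C = dec (21 + m) (off + 2) ∷ dec 20 off ∷ []
  zeroed : ∀ S₁ → S₁ (21 + m) ≡ 0 → ∀ S' → (∀ q → q < m → S' (21 + q) ≡ 0) →
       (∀ i → (i < 21 ⊎ 21 + m ≤ i) → S' i ≡ S₁ i) → ∀ q → q < suc m → S' (21 + q) ≡ 0
  zeroed S₁ a S' c d q q<1+m with m≤n⇒m<n∨m≡n (s≤s⁻¹ q<1+m)
  ... | inj₁ q<m = c q q<m
  ... | inj₂ refl = trans (d (21 + m) (inj₂ ≤-refl)) a
  kept : ∀ S₁ → (∀ i → i ≢ 21 + m → S₁ i ≡ S i) → ∀ S' →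
       (∀ i → (i < 21 ⊎ 21 + m ≤ i) → S' i ≡ S₁ i) → ∀ i → (i < 21 ⊎ 21 + suc m ≤ i) → S' i ≡ S i
  kept S₁ b S' d i (inj₁ lt) = trans (d i (inj₁ lt)) (b i (λ eq → <-irrefl refl (<-≤-trans (subst (_< 21) eq lt) (m≤m+n 21 m))))
  kept S₁ b S' d i (inj₂ le) = trans (d i (inj₂ (≤-trans (n≤1+n _) (subst (_≤ i) (+-suc 21 m) le))))
    (b i (λ eq → <-irrefl refl (subst (λ k → 21 + m < k) eq (subst (_≤ i) (+-suc 21 m) le))))

fetch-instrReg≤maxReg : ∀ p n {ins} → fetch p n ≡ just ins → instrReg ins ≤ maxReg p
fetch-instrReg≤maxReg (x ∷ p) zero refl = m≤m⊔n (instrReg x) (maxReg p)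
fetch-instrReg≤maxReg (x ∷ p) (suc n) eq = ≤-trans (fetch-instrReg≤maxReg p n eq) (m≤n⊔m (instrReg x) (maxReg p))

module Relocation (O : ℕ → ℕ) (P p : Program) (o : ℕ) (Slow : Registers) where

  L = length p
  M = maxReg p

  Shifted : Registers → Registers → Set
  Shifted R S = (∀ q → q ≤ M → S (21 + q) ≡ R q) × (∀ i → i < 21 → S i ≡ Slow i)

  shifted-update : ∀ {R S} r v → r ≤ M → Shifted R S → Shifted (update R r v) (update S (21 + r) v)
  shifted-update {R} {S} r v r≤M (high , low) = high′ , low′
    where
    high′ : ∀ q → q ≤ M → update S (21 + r) v (21 + q) ≡ update R r v q
    high′ q q≤M with q ≟ r
    ... | yes refl = update-≡ S (21 + r) v
    ... | no q≢r = trans (update-≢ S (21 + r) v (21 + q) (λ x → q≢r (+-cancelˡ-≡ 21 q r x))) (high q q≤M)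
    low′ : ∀ i → i < 21 → update S (21 + r) v i ≡ Slow i
    low′ i lt = trans (update-≢ S (21 + r) v i (λ x → <-irrefl refl (<-≤-trans (subst (_< 21) x lt) (m≤m+n 21 r)))) (low i lt)

  pc-next : ∀ n → n < L → suc (o + n) ≡ o + (suc n ⊓ L)
  pc-next n lt = trans (sym (+-suc o n)) (cong (o +_) (sym (m≤n⇒m⊓n≡m lt)))

  step-simulated : ∀ n R S ins → fetch p n ≡ just ins → n < L → Shifted R S →
    pc (stepInstr O (relocate o L ins) (o + n) S) ≡ o + (pc (stepInstr O ins n R) ⊓ L) ×
    Shifted (regs (stepInstr O ins n R)) (regs (stepInstr O (relocate o L ins) (o + n) S))
  step-simulated n R S (inc r) f lt sh =
    pc-next n lt , subst (λ w → Shifted (update R r (suc (R r))) (update S (21 + r) (suc w))) (sym (proj₁ sh r r≤M)) (shifted-update r _ r≤M sh)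
    where r≤M = fetch-instrReg≤maxReg p n f
  step-simulated n R S (query r) f lt sh =
    pc-next n lt , subst (λ w → Shifted (update R r (O (R r))) (update S (21 + r) (O w))) (sym (proj₁ sh r r≤M)) (shifted-update r _ r≤M sh)
    where r≤M = fetch-instrReg≤maxReg p n f
  step-simulated n R S (dec r j) f lt sh = by-cases (R r) refl
    where
    r≤M = fetch-instrReg≤maxReg p n f
    by-cases : ∀ w → R r ≡ w → pc (stepInstr O (relocate o L (dec r j)) (o + n) S) ≡ o + (pc (stepInstr O (dec r j) n R) ⊓ L) ×
           Shifted (regs (stepInstr O (dec r j) n R)) (regs (stepInstr O (relocate o L (dec r j)) (o + n) S))
    by-cases zero eq
      rewrite stepInstr-dec-zero O r j n R eq | stepInstr-dec-zero O (21 + r) (o + (j ⊓ L)) (o + n) S (trans (proj₁ sh r r≤M) eq) = refl , sh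
    by-cases (suc v) eq
      rewrite stepInstr-dec-suc O r j n R v eq | stepInstr-dec-suc O (21 + r) (o + (j ⊓ L)) (o + n) S v (trans (proj₁ sh r r≤M) eq) =
      pc-next n lt , shifted-update r v r≤M sh

  run-simulated : Embeds P o (map (relocate o L) p) → ∀ t n R S → Shifted R S → L ≤ pc (run O p t (cfg n R)) →
    Reaches O P (o + (n ⊓ L)) S (o + L) (Shifted (regs (run O p t (cfg n R))))
  run-simulated e zero n R S sh h =
    reach-start-≡ {Q = Shifted R} (cong (o +_) (sym (m≥n⇒m⊓n≡n h))) (reach-refl {Q = Shifted R} sh)
  run-simulated e (suc t) n R S sh h with L ≤? n
  ... | yes L≤n rewrite step-halted O p n R (fetch-≥length p n L≤n) = run-simulated e t n R S sh h
  ... | no L≰n = from (fetch-<length p n n<L)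
    where
    n<L = ≰⇒> L≰n
    from : (Σ Instr λ ins → fetch p n ≡ just ins) → Reaches O P (o + (n ⊓ L)) S (o + L) (Shifted (regs (run O p (suc t) (cfg n R))))
    from (ins , f) rewrite step-fetch O p n R ins f | m≤n⇒m⊓n≡m (<⇒≤ n<L) =
      reach-step {Q = Shifted (regs (run O p t (stepInstr O ins n R)))} (relocate o L ins) (e n (trans (fetch-map _ p n) (cong (Maybe.map _) f)))
        (reach-start-≡ {Q = Shifted (regs (run O p t (stepInstr O ins n R)))} (sym (proj₁ sim))
          (run-simulated e t (pc (stepInstr O ins n R)) (regs (stepInstr O ins n R)) (regs (stepInstr O (relocate o L ins) (o + n) S)) (proj₂ sim)
            (subst (λ C → L ≤ pc (run O p t C)) (step-fetch O p n R ins f) h)))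
      where sim = step-simulated n R S ins f n<L sh

compileCall-correct : ∀ {O p a R y} → Halts O p (val R a) y → ∀ P o S → Embeds P o (compileCall o p (toℕ a)) → Represents R S →
  Reaches O P o S (o + callSize p) (Represents (upd R a y))
compileCall-correct {O} {p} {a} {R} {y} (t , halted , output) P o S e g =
  reach-trans {Q1 = BlockZeroed m S} {Q2 = Represents R′}
    (clearBlock-reaches o m (embeds-++ˡ P o X _ e) S (zero-20 g)) λ S₁ (c₁ , c₂) →
  reach-trans {Q1 = Transferred A 21 S₁} {Q2 = Represents R′}
    (transfer-reaches o₁ A 21 eY A≢21 A≢20 (λ ()) S₁ (trans (c₂ 20 (inj₁ ≤-refl)) (zero-20 g))) λ S₂ (m₁ , m₂ , m₃) →
  reach-trans {Q1 = Shifted S₂ (regs (run O p t (initial x)))} {Q2 = Represents R′}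
    (reach-start-≡ {Q = Shifted S₂ (regs (run O p t (initial x)))} (+-identityʳ o₂)
      (run-simulated S₂ eZ t 0 (regs (initial x)) S₂ (loaded S₁ c₁ c₂ S₂ m₂ m₃) halted)) λ S₃ (h₃ , l₃) →
  reach-end-≡ {Q = Represents R′} (callSize-offset o (2 * m) L)
  (reach-trans {Q1 = Transferred 21 A S₃} {Q2 = Represents R′}
    (transfer-reaches o₃ 21 A eW (λ x → A≢21 (sym x)) (λ ()) A≢20 S₃ (trans (l₃ 20 ≤-refl) (S₂-20 S₁ c₂ S₂ m₃)))
    λ S₄ (_ , n₂ , n₃) → reach-refl {Q = Represents R′} (unloaded S₁ c₂ S₂ m₁ m₃ S₃ h₃ l₃ S₄ n₂ n₃))
  where
  A = toℕ a
  x = val R a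
  R′ = upd R a y
  M = maxReg p
  m = suc M
  L = length p
  o₁ = o + 2 * m
  o₂ = o₁ + 3
  o₃ = o₂ + L
  open Relocation O P p o₂ using (Shifted; run-simulated)
  X = clearBlock o m
  Y = transfer o₁ A 21
  Z = map (relocate o₂ L) p
  W = transfer o₃ 21 A
  eYZW : Embeds P o₁ (Y ++ (Z ++ W))
  eYZW = subst (λ k → Embeds P (o + k) (Y ++ (Z ++ W))) (length-clearBlock o m) (embeds-++ʳ P o X _ e)
  eY : Embeds P o₁ Y
  eY = embeds-++ˡ P o₁ Y _ eYZW
  eZW : Embeds P o₂ (Z ++ W)
  eZW = embeds-++ʳ P o₁ Y _ eYZW
  eZ : Embeds P o₂ Z
  eZ = embeds-++ˡ P o₂ Z W eZW
  eW : Embeds P o₃ W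
  eW = subst (λ k → Embeds P (o₂ + k) W) (length-map _ p) (embeds-++ʳ P o₂ Z W eZW)
  callSize-offset : ∀ o a b → o + a + 3 + b + 3 ≡ o + (a + (3 + (b + 3)))
  callSize-offset = solve-∀
  A<21 : A < 21
  A<21 = ≤-trans (toℕ<n a) (n≤1+n 20)
  A≢21 : A ≢ 21
  A≢21 eq = <-irrefl eq A<21
  A≢20 : A ≢ 20
  A≢20 eq = <-irrefl eq (toℕ<n a)
  reg≢21 : ∀ (i : Reg) → toℕ i ≢ 21
  reg≢21 i eq = <-irrefl eq (≤-trans (toℕ<n i) (n≤1+n 20))
  loaded : ∀ S₁ → (∀ q → q < m → S₁ (21 + q) ≡ 0) → (∀ i → (i < 21 ⊎ 21 + m ≤ i) → S₁ i ≡ S i) →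
       ∀ S₂ → S₂ 21 ≡ S₁ 21 + S₁ A → (∀ i → i ≢ A → i ≢ 21 → S₂ i ≡ S₁ i) →
       Shifted S₂ (regs (initial x)) S₂
  loaded S₁ c₁ c₂ S₂ m₂ m₃ = high , λ i _ → refl
    where
    high : ∀ q → q ≤ M → S₂ (21 + q) ≡ regs (initial x) q
    high zero _ = trans m₂ (trans (cong (_+ S₁ A) (c₁ 0 (s≤s z≤n))) (trans (c₂ A (inj₁ A<21)) (agree g a)))
    high (suc q) le = trans (m₃ (21 + suc q) (λ eq → <-irrefl (sym eq) (≤-trans A<21 (m≤m+n 21 (suc q)))) (λ ())) (c₁ (suc q) (s≤s le))
  S₂-20 : ∀ S₁ → (∀ i → (i < 21 ⊎ 21 + m ≤ i) → S₁ i ≡ S i) → ∀ S₂ → (∀ i → i ≢ A → i ≢ 21 → S₂ i ≡ S₁ i) → S₂ 20 ≡ 0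
  S₂-20 S₁ c₂ S₂ m₃ = trans (m₃ 20 (λ x → A≢20 (sym x)) (λ ())) (trans (c₂ 20 (inj₁ ≤-refl)) (zero-20 g))
  unloaded : ∀ S₁ → (∀ i → (i < 21 ⊎ 21 + m ≤ i) → S₁ i ≡ S i) → ∀ S₂ → S₂ A ≡ 0 → (∀ i → i ≢ A → i ≢ 21 → S₂ i ≡ S₁ i) →
        ∀ S₃ → (∀ q → q ≤ M → S₃ (21 + q) ≡ regs (run O p t (initial x)) q) → (∀ i → i < 21 → S₃ i ≡ S₂ i) →
        ∀ S₄ → S₄ A ≡ S₃ A + S₃ 21 → (∀ i → i ≢ 21 → i ≢ A → S₄ i ≡ S₃ i) → Represents R′ S₄
  unloaded S₁ c₂ S₂ m₁ m₃ S₃ h₃ l₃ S₄ n₂ n₃ =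
    represents agree′ (trans (n₃ 20 (λ ()) (λ x → A≢20 (sym x))) (trans (l₃ 20 ≤-refl) (S₂-20 S₁ c₂ S₂ m₃)))
    where
    agree′ : ∀ (i : Reg) → S₄ (toℕ i) ≡ update R A y (toℕ i)
    agree′ i with toℕ i ≟ A
    ... | yes eq = trans (cong S₄ eq) (trans n₂ (cong₂ _+_ (trans (l₃ A A<21) m₁) (trans (h₃ 0 z≤n) output)))
    ... | no ne = trans (n₃ (toℕ i) (reg≢21 i) ne) (trans (l₃ (toℕ i) (≤-trans (toℕ<n i) (n≤1+n 20)))
                   (trans (m₃ (toℕ i) ne (reg≢21 i)) (trans (c₂ (toℕ i) (inj₁ (≤-trans (toℕ<n i) (n≤1+n 20)))) (agree g i))))

represents-step : ∀ {R S} (r : Reg) (f : ℕ → ℕ) → Represents R S →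
  Represents (upd R r (f (val R r))) (update S (toℕ r) (f (S (toℕ r))))
represents-step {R} {S} r f g =
  subst (λ w → Represents (upd R r (f w)) (update S (toℕ r) (f (S (toℕ r))))) (agree g r) (represents-upd r _ g)

compile-correct : ∀ {O c R R'} → Exec O c R R' → ∀ P o S → Embeds P o (compile o c) → Represents R S →
  Reaches O P o S (o + size c) (Represents R')
compile-correct {R' = R'} eSKIP P o S e g =
  reach-end-≡ {Q = Represents R'} (sym (+-identityʳ o)) (reach-refl {Q = Represents R'} g)
compile-correct {R' = R'} (eINC {r}) P o S e g =
  reach-step {Q = Represents R'} (inc (toℕ r)) (embeds-head P o _ _ e)
    (reach-end-≡ {Q = Represents R'} (+-comm 1 o) (reach-refl {Q = Represents R'} (represents-step r suc g)))
compile-correct {O} {R' = R'} (eQRY {r}) P o S e g =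
  reach-step {Q = Represents R'} (query (toℕ r)) (embeds-head P o _ _ e)
    (reach-end-≡ {Q = Represents R'} (+-comm 1 o) (reach-refl {Q = Represents R'} (represents-step r O g)))
compile-correct {R' = R'} (eDEC {r}) P o S e g =
  reach-dec {Q = Represents R'} (toℕ r) (suc o) (embeds-head P o _ _ e)
    (λ z → reach-end-≡ {Q = Represents R'} (+-comm 1 o) (reach-refl {Q = Represents R'} (represents-dec-zero r g z)))
    (λ v s → reach-end-≡ {Q = Represents R'} (+-comm 1 o) (reach-refl {Q = Represents R'}
       (subst (λ w → Represents R' (update S (toℕ r) w)) (cong pred s) (represents-step r pred g))))
compile-correct {R' = R'} (eSEQ {c} {d} {R1 = R1} x y) P o S e g =
  reach-trans {Q1 = Represents R1} {Q2 = Represents R'} (compile-correct x P o S (embeds-++ˡ P o (compile o c) _ e) g) λ S₁ g₁ →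
  reach-end-≡ {Q = Represents R'} (+-assoc o (size c) (size d)) (compile-correct y P (o + size c) S₁
    (subst (λ k → Embeds P (o + k) (compile (o + size c) d)) (length-compile o c) (embeds-++ʳ P o (compile o c) _ e)) g₁)
compile-correct {R' = R'} (eIF0 {r} z) P o S e g =
  reach-dec-zero {Q = Represents R'} (toℕ r) _ (embeds-head P o _ _ e) (trans (agree g r) z) (reach-refl {Q = Represents R'} g)
compile-correct {R' = R'} (eIFS {r} {c} {v = v} s x) P o S e g =
  reach-dec-suc {Q = Represents R'} (toℕ r) _ v (embeds-head P o _ _ e) (trans (agree g r) s)
    (reach-end-≡ {Q = Represents R'} (sym (+-suc o (size c)))
      (compile-correct x P (suc o) (update S (toℕ r) v) (embeds-∷ P o _ _ e) (represents-upd r v g)))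
compile-correct {R' = R'} (eL0 {r} z) P o S e g =
  reach-dec-zero {Q = Represents R'} (toℕ r) _ (embeds-head P o _ _ e) (trans (agree g r) z) (reach-refl {Q = Represents R'} g)
compile-correct {R' = R'} (eLS {r} {c} {R1 = R1} {v = v} s x y) P o S e g =
  reach-dec-suc {Q = Represents R'} (toℕ r) _ v (embeds-head P o _ _ e) (trans (agree g r) s)
    (reach-trans {Q1 = Represents R1} {Q2 = Represents R'}
      (compile-correct x P (suc o) (update S (toℕ r) v) (embeds-++ˡ P (suc o) (compile (suc o) c) _ (embeds-∷ P o _ _ e)) (represents-upd r v g))
      λ S₁ g₁ → reach-dec-zero {Q = Represents R'} 20 o jump-back (zero-20 g₁) (compile-correct y P o S₁ e g₁))
  where
  jump-back : fetch P (suc o + size c) ≡ just (dec 20 o)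
  jump-back = subst (λ k → fetch P k ≡ just (dec 20 o)) (trans (+-identityʳ _) (cong (suc o +_) (length-compile (suc o) c)))
    (embeds-++ʳ P (suc o) (compile (suc o) c) (dec 20 o ∷ []) (embeds-∷ P o _ _ e) 0 refl)
compile-correct (eCALL h) P o S e g = compileCall-correct h P o S e g

-- Cantor pairing

triangle : ℕ → ℕ
triangle zero = 0
triangle (suc s) = suc s + triangle s

pair : ℕ → ℕ → ℕ
pair a b = triangle (a + b) + a

unpairStep : ℕ × ℕ → ℕ × ℕ
unpairStep (a , zero) = 0 , suc a
unpairStep (a , suc b) = suc a , b

unpairStep^ : ℕ → ℕ × ℕ → ℕ × ℕ
unpairStep^ zero x = x
unpairStep^ (suc n) x = unpairStep^ n (unpairStep x)

unpair-suc : ∀ m → unpair (suc m) ≡ unpairStep (unpair m)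
unpair-suc m with unpair m
... | a , zero = refl
... | a , suc b = refl

unpairStep^-unpair : ∀ n m → unpairStep^ n (unpair m) ≡ unpair (n + m)
unpairStep^-unpair zero m = refl
unpairStep^-unpair (suc n) m =
  trans (cong (unpairStep^ n) (sym (unpair-suc m))) (trans (unpairStep^-unpair n (suc m)) (cong unpair (+-suc n m)))

unpair-triangle+ : ∀ s a → a ≤ s → unpair (triangle s + a) ≡ (a , s ∸ a)
unpair-triangle+ zero zero _ = refl
unpair-triangle+ (suc s) zero _ = begin
  unpair (suc s + triangle s + 0)          ≡⟨ cong unpair (+-identityʳ (suc s + triangle s)) ⟩
  unpair (suc (s + triangle s))            ≡⟨ unpair-suc (s + triangle s) ⟩
  unpairStep (unpair (s + triangle s))     ≡⟨ cong (unpairStep ∘′ unpair) (+-comm s (triangle s)) ⟩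
  unpairStep (unpair (triangle s + s))     ≡⟨ cong unpairStep (unpair-triangle+ s s ≤-refl) ⟩
  unpairStep (s , s ∸ s)                   ≡⟨ cong (λ w → unpairStep (s , w)) (n∸n≡0 s) ⟩
  (0 , suc s)                              ∎
  where open ≡-Reasoning
unpair-triangle+ s (suc a) a<s = begin
  unpair (triangle s + suc a)              ≡⟨ cong unpair (+-suc (triangle s) a) ⟩
  unpair (suc (triangle s + a))            ≡⟨ unpair-suc (triangle s + a) ⟩
  unpairStep (unpair (triangle s + a))     ≡⟨ cong unpairStep (unpair-triangle+ s a (<⇒≤ a<s)) ⟩
  unpairStep (a , s ∸ a)                   ≡⟨ cong (λ w → unpairStep (a , w)) (+-∸-assoc 1 a<s) ⟩
  (suc a , s ∸ suc a)                      ∎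
  where open ≡-Reasoning

unpair-pair : ∀ a b → unpair (pair a b) ≡ (a , b)
unpair-pair a b = trans (unpair-triangle+ (a + b) a (m≤m+n a b)) (cong (a ,_) (m+n∸m≡n a b))

unpair-≤ : ∀ m → proj₁ (unpair m) ≤ m × proj₂ (unpair m) ≤ m
unpair-≤ zero = z≤n , z≤n
unpair-≤ (suc m) rewrite unpair-suc m = bounded (unpair m) (unpair-≤ m)
  where
  bounded : ∀ ab → proj₁ ab ≤ m × proj₂ ab ≤ m → proj₁ (unpairStep ab) ≤ suc m × proj₂ (unpairStep ab) ≤ suc m
  bounded (a , zero) (a≤m , _) = z≤n , s≤s a≤m
  bounded (a , suc b) (a≤m , b<m) = s≤s a≤m , m≤n⇒m≤1+n (<⇒≤ b<m)

triangle-mono-≤ : ∀ {s t} → s ≤ t → triangle s ≤ triangle t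
triangle-mono-≤ {zero} le = z≤n
triangle-mono-≤ {suc s} {suc t} (s≤s le) = +-mono-≤ (s≤s le) (triangle-mono-≤ le)

pair-mono-≤ : ∀ {a a' b b'} → a ≤ a' → b ≤ b' → pair a b ≤ pair a' b'
pair-mono-≤ a≤a' b≤b' = +-mono-≤ (triangle-mono-≤ (+-mono-≤ a≤a' b≤b')) a≤a'

n≤triangle : ∀ s → s ≤ triangle s
n≤triangle zero = z≤n
n≤triangle (suc s) = s≤s (m≤m+n s (triangle s))

n≤pair : ∀ a b → b ≤ pair a b
n≤pair a b = ≤-trans (m≤n+m b a) (≤-trans (n≤triangle (a + b)) (m≤m+n (triangle (a + b)) a))

Runs : (ℕ → ℕ) → Cmd → Registers → (Registers → Set) → Set
Runs O c R Q = Σ Registers λ R' → Exec O c R R' × Q R'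

runs-seq : ∀ {O c d R} {Q1 Q2 : Registers → Set} → Runs O c R Q1 → (∀ R1 → Q1 R1 → Runs O d R1 Q2) → Runs O (SEQ c d) R Q2
runs-seq (R1 , e1 , q1) k with k R1 q1
... | R2 , e2 , q2 = R2 , eSEQ e1 e2 , q2

runs-weaken : ∀ {O c R} {Q1 Q2 : Registers → Set} → Runs O c R Q1 → (∀ R' → Q1 R' → Q2 R') → Runs O c R Q2
runs-weaken (R' , e , q) f = R' , e , f R' q

runs-loop-step : ∀ {O r c R v} {Q1 Q2 : Registers → Set} → val R r ≡ suc v →
  Runs O c (upd R r v) Q1 → (∀ R1 → Q1 R1 → Runs O (LOOP r c) R1 Q2) → Runs O (LOOP r c) R Q2
runs-loop-step r≡1+v (R1 , e1 , q1) k with k R1 q1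
... | R2 , e2 , q2 = R2 , eLS r≡1+v e1 e2 , q2

assigned : ∀ R (r : Reg) v → Assigned (toℕ r) v R (upd R r v)
assigned R r v = update-≡ R (toℕ r) v , update-≢ R (toℕ r) v

CLEAR : Reg → Cmd
CLEAR a = LOOP a SKIP

clear-runs : ∀ {O} a R → Runs O (CLEAR a) R (Assigned (toℕ a) 0 R)
clear-runs {O} a R = go (val R a) R refl
  where
  go : ∀ v R → val R a ≡ v → Runs O (CLEAR a) R (Assigned (toℕ a) 0 R)
  go zero R e = R , eL0 e , e , λ i _ → refl
  go (suc v) R e with go v (upd R a v) (update-≡ R (toℕ a) v)
  ... | R' , ex , z , fr = R' , eLS e eSKIP ex , z , λ i ne → trans (fr i ne) (update-≢ R (toℕ a) v i ne)

MOVE : Reg → Reg → Cmd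
MOVE a b = LOOP a (INC b)

move-runs : ∀ {O} a b → toℕ a ≢ toℕ b → ∀ R → Runs O (MOVE a b) R (Transferred (toℕ a) (toℕ b) R)
move-runs {O} a b ab R = go (val R a) R refl
  where
  A = toℕ a
  B = toℕ b
  go : ∀ v R → val R a ≡ v → Runs O (MOVE a b) R (Transferred A B R)
  go zero R e = R , eL0 e , e , sym (trans (cong (R B +_) e) (+-identityʳ _)) , λ i _ _ → refl
  go (suc v) R e with go v R2 r2a
    where
    R1 = upd R a v
    R2 = upd R1 b (suc (val R1 b))
    r2a : val R2 a ≡ v
    r2a = trans (update-≢ R1 B _ A ab) (update-≡ R A v)
  ... | R' , ex , z , eb , fr = R' , eLS e eINC ex , z ,
        trans eb (trans (cong₂ _+_ (trans (update-≡ (upd R a v) B _) (cong suc (update-≢ R A v B (λ x → ab (sym x))))) (trans (update-≢ (upd R a v) B _ A ab) (update-≡ R A v)))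
          (trans (sym (+-suc (R B) v)) (cong (R B +_) (sym e)))) ,
        λ i ia ib → trans (fr i ia ib) (trans (update-≢ (upd R a v) B _ i ib) (update-≢ R A v i ia))

AddedTwice : ℕ → ℕ → ℕ → Registers → Registers → Set
AddedTwice t a b R R' = R' t ≡ 0 × R' a ≡ R a + R t × R' b ≡ R b + R t × (∀ i → i ≢ t → i ≢ a → i ≢ b → R' i ≡ R i)

add-twice-runs : ∀ {O} t a b → toℕ t ≢ toℕ a → toℕ t ≢ toℕ b → toℕ a ≢ toℕ b → ∀ R →
  Runs O (LOOP t (SEQ (INC a) (INC b))) R (AddedTwice (toℕ t) (toℕ a) (toℕ b) R)
add-twice-runs {O} t a b ta tb ab R = go (val R t) R refl
  where
  A = toℕ a
  B = toℕ b
  Tt = toℕ t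
  go : ∀ v R → val R t ≡ v → Runs O (LOOP t (SEQ (INC a) (INC b))) R (AddedTwice Tt A B R)
  go zero R e = R , eL0 e , e , sym (trans (cong (R A +_) e) (+-identityʳ _)) , sym (trans (cong (R B +_) e) (+-identityʳ _)) , λ i _ _ _ → refl
  go (suc v) R e with go v R3 r3t
    where
    R1 = upd R t v
    R2 = upd R1 a (suc (val R1 a))
    R3 = upd R2 b (suc (val R2 b))
    r3t : val R3 t ≡ v
    r3t = trans (update-≢ R2 B _ Tt tb) (trans (update-≢ R1 A _ Tt ta) (update-≡ R Tt v))
  ... | R' , ex , z , ea , eb , fr = R' , eLS e (eSEQ eINC eINC) ex , z ,
        trans ea (trans (cong₂ _+_ (trans (update-≢ R2 B _ A ab) (trans (update-≡ R1 A _) (cong suc (update-≢ R Tt v A (λ x → ta (sym x))))))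
                                 (trans (update-≢ R2 B _ Tt tb) (trans (update-≢ R1 A _ Tt ta) (update-≡ R Tt v))))
          (trans (sym (+-suc (R A) v)) (cong (R A +_) (sym e)))) ,
        trans eb (trans (cong₂ _+_ (trans (update-≡ R2 B _) (cong suc (trans (update-≢ R1 A _ B (λ x → ab (sym x))) (update-≢ R Tt v B (λ x → tb (sym x))))))
                                 (trans (update-≢ R2 B _ Tt tb) (trans (update-≢ R1 A _ Tt ta) (update-≡ R Tt v))))
          (trans (sym (+-suc (R B) v)) (cong (R B +_) (sym e)))) ,
        λ i i≢t ia ib → trans (fr i i≢t ia ib) (trans (update-≢ R2 B _ i ib) (trans (update-≢ R1 A _ i ia) (update-≢ R Tt v i i≢t)))
    where
    R1 = upd R t v
    R2 = upd R1 a (suc (val R1 a))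

ADDTO : Reg → Reg → Cmd
ADDTO a b = SEQ (CLEAR (# 19)) (SEQ (MOVE a (# 19)) (LOOP (# 19) (SEQ (INC a) (INC b))))

AddedTo : ℕ → ℕ → Registers → Registers → Set
AddedTo a b R R' = R' a ≡ R a × R' b ≡ R b + R a × R' 19 ≡ 0 × (∀ i → i ≢ b → i ≢ 19 → R' i ≡ R i)

addto-runs : ∀ {O} a b → toℕ a ≢ toℕ b → toℕ a ≢ 19 → toℕ b ≢ 19 → ∀ R → Runs O (ADDTO a b) R (AddedTo (toℕ a) (toℕ b) R)
addto-runs {O} a b ab a19 b19 R =
  runs-seq {Q1 = Assigned 19 0 R} (clear-runs (# 19) R) λ R1 (c1 , c2) →
  runs-seq {Q1 = Transferred A 19 R1} (move-runs a (# 19) a19 R1) λ R2 (m1 , m2 , m3) →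
  runs-weaken (add-twice-runs (# 19) a b (λ x → a19 (sym x)) (λ x → b19 (sym x)) ab R2) λ R3 (d1 , d2 , d3 , d4) →
    let r2t = trans m2 (trans (cong (_+ R1 A) c1) (c2 A a19))
        r3a = trans d2 (trans (cong (_+ R2 19) m1) r2t) in
    r3a ,
    trans d3 (cong₂ _+_ (trans (m3 B (λ x → ab (sym x)) b19) (c2 B b19)) r2t) , d1 ,
    λ i ib i19 → fr R1 c2 R2 m3 R3 r3a d4 i ib i19
  where
  A = toℕ a
  B = toℕ b
  fr : ∀ R1 → (∀ i → i ≢ 19 → R1 i ≡ R i) → ∀ R2 → (∀ i → i ≢ A → i ≢ 19 → R2 i ≡ R1 i) → ∀ R3 → R3 A ≡ R A →
       (∀ i → i ≢ 19 → i ≢ A → i ≢ B → R3 i ≡ R2 i) → ∀ i → i ≢ B → i ≢ 19 → R3 i ≡ R i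
  fr R1 c2 R2 m3 R3 r3a d4 i ib i19 with i ≟ A
  ... | yes refl = r3a
  ... | no ia = trans (d4 i i19 ia ib) (trans (m3 i ia i19) (c2 i i19))

TRIANGLE : Reg → Reg → Cmd
TRIANGLE c d = SEQ (CLEAR (# 19)) (LOOP c (SEQ (ADDTO c d) (INC d)))

TriangleAdded : ℕ → ℕ → Registers → Registers → Set
TriangleAdded c d R R' = R' c ≡ 0 × R' d ≡ R d + triangle (R c) × R' 19 ≡ 0 × (∀ i → i ≢ c → i ≢ d → i ≢ 19 → R' i ≡ R i)

triangle-runs : ∀ {O} c d → toℕ c ≢ toℕ d → toℕ c ≢ 19 → toℕ d ≢ 19 → ∀ R → Runs O (TRIANGLE c d) R (TriangleAdded (toℕ c) (toℕ d) R)
triangle-runs {O} c d cd c19 d19 R =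
  runs-seq {Q1 = Assigned 19 0 R} (clear-runs (# 19) R) λ R1 (c1 , c2) →
  runs-weaken (go (val R1 c) R1 refl c1) λ R' (a1 , a2 , a3 , a4) →
    a1 , trans a2 (cong₂ _+_ (c2 D d19) (cong triangle (c2 C c19))) , a3 ,
    λ i ic id i19 → trans (a4 i ic id i19) (c2 i i19)
  where
  C = toℕ c
  D = toℕ d
  LP = LOOP c (SEQ (ADDTO c d) (INC d))
  shuffle : ∀ x v t → suc (x + v) + t ≡ x + (suc v + t)
  shuffle = solve-∀
  go : ∀ v R → val R c ≡ v → R 19 ≡ 0 → Runs O LP R (TriangleAdded C D R)
  go zero R e z = R , eL0 e , e , sym (trans (cong (λ x → R D + triangle x) e) (+-identityʳ _)) , z , λ i _ _ _ → refl
  go (suc v) R e z with addto-runs {O} c d cd c19 d19 (upd R c v)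
  ... | R2 , ex2 , b1 , b2 , b3 , b4 with go v (upd R2 d (suc (R2 D)))
          (trans (update-≢ R2 D _ C cd) (trans b1 (update-≡ R C v)))
          (trans (update-≢ R2 D _ 19 (λ x → d19 (sym x))) b3)
  ... | R' , ex , a1 , a2 , a3 , a4 = R' , eLS e (eSEQ ex2 eINC) ex , a1 ,
        trans a2 (trans (cong₂ _+_ (trans (update-≡ R2 D _) (cong suc (trans b2 (cong₂ _+_ (update-≢ R C v D (λ x → cd (sym x))) (update-≡ R C v)))))
                                   (cong triangle (trans (update-≢ R2 D _ C cd) (trans b1 (update-≡ R C v)))))
           (trans (shuffle (R D) v (triangle v)) (cong (λ x → R D + triangle x) (sym e)))) , a3 ,
        λ i ic id i19 → trans (a4 i ic id i19) (trans (update-≢ R2 D _ i id) (trans (b4 i id i19) (update-≢ R C v i ic)))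

PAIR : Reg → Reg → Reg → Cmd
PAIR a b d = SEQ (CLEAR (# 18)) (SEQ (ADDTO a (# 18)) (SEQ (ADDTO b (# 18)) (SEQ (CLEAR d) (SEQ (TRIANGLE (# 18) d) (ADDTO a d)))))

Paired : ℕ → ℕ → ℕ → Registers → Registers → Set
Paired a b d R R' = R' d ≡ pair (R a) (R b) × (∀ i → i ≢ d → i ≢ 18 → i ≢ 19 → R' i ≡ R i)

pair-runs : ∀ {O} a b d → toℕ a < 18 → toℕ b < 18 → toℕ d < 18 → toℕ a ≢ toℕ d → ∀ R →
  Runs O (PAIR a b d) R (Paired (toℕ a) (toℕ b) (toℕ d) R)
pair-runs {O} a b d a18 b18 d18 ad R =
  runs-seq {Q1 = Assigned 18 0 R} (clear-runs (# 18) R) λ R1 (c1 , c2) →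
  runs-seq {Q1 = AddedTo A 18 R1} (addto-runs a (# 18) a≢18 a≢19 (λ ()) R1) λ R2 (e1 , e2 , e3 , e4) →
  runs-seq {Q1 = AddedTo B 18 R2} (addto-runs b (# 18) b≢18 b≢19 (λ ()) R2) λ R3 (f1 , f2 , f3 , f4) →
  runs-seq {Q1 = Assigned D 0 R3} (clear-runs d R3) λ R4 (g1 , g2) →
  runs-seq {Q1 = TriangleAdded 18 D R4} (triangle-runs (# 18) d (λ x → d≢18 (sym x)) (λ ()) d≢19 R4) λ R5 (h1 , h2 , h3 , h4) →
  runs-weaken (addto-runs a d ad a≢19 d≢19 R5) λ R6 (k1 , k2 , k3 , k4) →
    let r1a = c2 A a≢18
        r2a = trans e1 r1a
        r2b = trans (e4 B b≢18 b≢19) (c2 B b≢18)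
        r3a = trans (f4 A a≢18 a≢19) r2a
        r3s = trans f2 (cong₂ _+_ (trans e2 (cong₂ _+_ c1 r1a)) r2b)
        r4a = trans (g2 A ad) r3a
        r4s = trans (g2 18 (λ x → d≢18 (sym x))) r3s
        r5a = trans (h4 A a≢18 ad a≢19) r4a
        r5d = trans h2 (trans (cong₂ _+_ g1 (cong triangle r4s)) refl) in
    trans k2 (cong₂ _+_ r5d r5a) ,
    λ i id i18 i19 → trans (k4 i id i19) (trans (h4 i i18 id i19) (trans (g2 i id) (trans (f4 i i18 i19) (trans (e4 i i18 i19) (c2 i i18)))))
  where
  A = toℕ a
  B = toℕ b
  D = toℕ d
  a≢18 = <⇒≢ a18
  a≢19 = <⇒≢ (m<n⇒m<1+n a18)
  b≢18 = <⇒≢ b18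
  b≢19 = <⇒≢ (m<n⇒m<1+n b18)
  d≢18 = <⇒≢ d18
  d≢19 = <⇒≢ (m<n⇒m<1+n d18)

UNPAIR-STEP : Reg → Reg → Cmd
UNPAIR-STEP a b = SEQ (CLEAR (# 16)) (SEQ (INC (# 16)) (SEQ (IFNZ b (SEQ (INC a) (DEC (# 16)))) (IFNZ (# 16) (SEQ (MOVE a b) (INC b)))))

UnpairStepped : ℕ → ℕ → Registers → Registers → Set
UnpairStepped a b R R' = R' a ≡ proj₁ (unpairStep (R a , R b)) × R' b ≡ proj₂ (unpairStep (R a , R b)) × (∀ i → i ≢ a → i ≢ b → i ≢ 16 → R' i ≡ R i)

unpair-step-runs : ∀ {O} a b → toℕ a ≢ toℕ b → toℕ a ≢ 16 → toℕ b ≢ 16 → ∀ R → Runs O (UNPAIR-STEP a b) R (UnpairStepped (toℕ a) (toℕ b) R)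
unpair-step-runs {O} a b ab a16 b16 R =
  runs-seq {Q1 = Assigned 16 0 R} (clear-runs (# 16) R) λ R1 (c1 , c2) → after-clear R1 c1 c2 (R B) refl
  where
  A = toℕ a
  B = toℕ b
  after-clear : ∀ R1 → R1 16 ≡ 0 → (∀ i → i ≢ 16 → R1 i ≡ R i) → ∀ w → R B ≡ w →
        Runs O (SEQ (INC (# 16)) (SEQ (IFNZ b (SEQ (INC a) (DEC (# 16)))) (IFNZ (# 16) (SEQ (MOVE a b) (INC b))))) R1 (UnpairStepped A B R)
  after-clear R1 c1 c2 (suc w) rb =
    let R2 = upd R1 (# 16) (suc (R1 16))
        R3 = upd R2 b w
        R4 = upd R3 a (suc (R3 A))
        R5 = upd R4 (# 16) (pred (R4 16)) in
    R5 , eSEQ eINC (eSEQ (eIFS (trans (update-≢ R1 16 _ B b16) (trans (c2 B b16) rb)) (eSEQ eINC eDEC))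
                          (eIF0 (trans (update-≡ R4 16 _) (cong pred (trans (update-≢ R3 A _ 16 (λ x → a16 (sym x)))
                              (trans (update-≢ R2 B w 16 (λ x → b16 (sym x))) (trans (update-≡ R1 16 _) (cong suc c1)))))))) ,
    subst (λ v → R5 A ≡ proj₁ (unpairStep (R A , v))) (sym rb)
      (trans (update-≢ R4 16 _ A a16) (trans (update-≡ R3 A _) (cong suc (trans (update-≢ R2 B w A ab) (trans (update-≢ R1 16 _ A a16) (c2 A a16)))))) ,
    subst (λ v → R5 B ≡ proj₂ (unpairStep (R A , v))) (sym rb)
      (trans (update-≢ R4 16 _ B b16) (trans (update-≢ R3 A _ B (λ x → ab (sym x))) (update-≡ R2 B w))) ,
    λ i ia ib i16 → trans (update-≢ R4 16 _ i i16) (trans (update-≢ R3 A _ i ia) (trans (update-≢ R2 B w i ib)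
      (trans (update-≢ R1 16 _ i i16) (c2 i i16))))
  after-clear R1 c1 c2 zero rb with move-runs {O} a b ab (upd (upd R1 (# 16) (suc (R1 16))) (# 16) 0)
  ... | R4 , ex4 , m1 , m2 , m3 =
        let R2 = upd R1 (# 16) (suc (R1 16))
            R5 = upd R4 b (suc (R4 B))
            r3a = trans (update-≢ R2 16 0 A a16) (trans (update-≢ R1 16 _ A a16) (c2 A a16))
            r3b = trans (update-≢ R2 16 0 B b16) (trans (update-≢ R1 16 _ B b16) (trans (c2 B b16) rb)) in
        R5 , eSEQ eINC (eSEQ (eIF0 (trans (update-≢ R1 16 _ B b16) (trans (c2 B b16) rb)))
                              (eIFS (trans (update-≡ R1 16 _) (cong suc c1)) (eSEQ ex4 eINC))) ,
        subst (λ v → R5 A ≡ proj₁ (unpairStep (R A , v))) (sym rb) (trans (update-≢ R4 B _ A ab) m1) ,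
        subst (λ v → R5 B ≡ proj₂ (unpairStep (R A , v))) (sym rb) (trans (update-≡ R4 B _) (cong suc (trans m2 (cong₂ _+_ r3b r3a)))) ,
        λ i ia ib i16 → trans (update-≢ R4 B _ i ib) (trans (m3 i ia ib) (trans (update-≢ R2 16 0 i i16)
          (trans (update-≢ R1 16 _ i i16) (c2 i i16))))

UNPAIR : Reg → Reg → Reg → Cmd
UNPAIR x a b = SEQ (CLEAR a) (SEQ (CLEAR b) (SEQ (CLEAR (# 17)) (SEQ (ADDTO x (# 17)) (LOOP (# 17) (UNPAIR-STEP a b)))))

Unpaired : ℕ → ℕ → ℕ → Registers → Registers → Set
Unpaired x a b R R' = R' a ≡ proj₁ (unpair (R x)) × R' b ≡ proj₂ (unpair (R x)) ×
  (∀ i → i ≢ a → i ≢ b → i ≢ 16 → i ≢ 17 → i ≢ 19 → R' i ≡ R i)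

unpair-runs : ∀ {O} x a b → toℕ x < 16 → toℕ a < 16 → toℕ b < 16 → toℕ x ≢ toℕ a → toℕ x ≢ toℕ b → toℕ a ≢ toℕ b →
  ∀ R → Runs O (UNPAIR x a b) R (Unpaired (toℕ x) (toℕ a) (toℕ b) R)
unpair-runs {O} x a b x16 a16 b16 xa xb ab R =
  runs-seq {Q1 = Assigned A 0 R} (clear-runs a R) λ R1 (c1 , c2) →
  runs-seq {Q1 = Assigned B 0 R1} (clear-runs b R1) λ R2 (d1 , d2) →
  runs-seq {Q1 = Assigned 17 0 R2} (clear-runs (# 17) R2) λ R3 (e1 , e2) →
  runs-seq {Q1 = AddedTo X 17 R3} (addto-runs x (# 17) x≢17 x≢19 (λ ()) R3) λ R4 (f1 , f2 , f3 , f4) →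
  runs-weaken (go (R4 17) R4 refl) λ R5 (g1 , g2 , g3) →
    let r4u = trans f2 (trans (cong (_+ R3 X) e1) (trans (e2 X x≢17) (trans (d2 X xb) (c2 X xa))))
        r4a = trans (f4 A a≢17 a≢19) (trans (e2 A a≢17) (trans (d2 A ab) c1))
        r4b = trans (f4 B b≢17 b≢19) (trans (e2 B b≢17) d1)
        unpaired = trans (cong (λ v → unpairStep^ (R4 17) v) (cong₂ _,_ r4a r4b)) (trans (unpairStep^-unpair (R4 17) 0) (cong unpair (trans (+-identityʳ _) r4u)))
    in trans g1 (cong proj₁ unpaired) , trans g2 (cong proj₂ unpaired) ,
       λ i ia ib i16 i17 i19 → trans (g3 i ia ib i16 i17) (trans (f4 i i17 i19) (trans (e2 i i17) (trans (d2 i ib) (c2 i ia))))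
  where
  X = toℕ x
  A = toℕ a
  B = toℕ b
  a≢16 = <⇒≢ a16
  b≢16 = <⇒≢ b16
  x≢17 = <⇒≢ (m<n⇒m<1+n x16)
  a≢17 = <⇒≢ (m<n⇒m<1+n a16)
  b≢17 = <⇒≢ (m<n⇒m<1+n b16)
  x≢19 = <⇒≢ (<-≤-trans x16 (m≤m+n 16 3))
  a≢19 = <⇒≢ (<-≤-trans a16 (m≤m+n 16 3))
  b≢19 = <⇒≢ (<-≤-trans b16 (m≤m+n 16 3))
  LP = LOOP (# 17) (UNPAIR-STEP a b)
  go : ∀ v R → R 17 ≡ v → Runs O LP R (λ R' → R' A ≡ proj₁ (unpairStep^ v (R A , R B)) × R' B ≡ proj₂ (unpairStep^ v (R A , R B)) ×
          (∀ i → i ≢ A → i ≢ B → i ≢ 16 → i ≢ 17 → R' i ≡ R i))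
  go zero R e = R , eL0 e , refl , refl , λ i _ _ _ _ → refl
  go (suc v) R e with unpair-step-runs {O} a b ab a≢16 b≢16 (upd R (# 17) v)
  ... | R2 , ex2 , s1 , s2 , s3 with go v R2 (trans (s3 17 (a≢17 ∘′ sym) (b≢17 ∘′ sym) (λ ())) (update-≡ R 17 v))
  ... | R' , ex , g1 , g2 , g3 =
    let st = cong₂ _,_ (trans s1 (cong proj₁ u)) (trans s2 (cong proj₂ u)) in
    R' , eLS e ex2 ex , trans g1 (cong (λ w → proj₁ (unpairStep^ v w)) st) , trans g2 (cong (λ w → proj₂ (unpairStep^ v w)) st) ,
    λ i ia ib i16 i17 → trans (g3 i ia ib i16 i17) (trans (s3 i ia ib i16) (update-≢ R 17 v i i17))
    where
    u : unpairStep (upd R (# 17) v A , upd R (# 17) v B) ≡ unpairStep (R A , R B)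
    u = cong₂ (λ p q → unpairStep (p , q)) (update-≢ R 17 v A a≢17) (update-≢ R 17 v B b≢17)

COPY-INPUT : Cmd
COPY-INPUT = SEQ (CLEAR (# 1)) (SEQ (MOVE (# 0) (# 1)) (SEQ (CLEAR (# 2)) (ADDTO (# 1) (# 2))))

copy-input-runs : ∀ {O} R → Runs O COPY-INPUT R (λ R' → R' 1 ≡ R 0 × R' 2 ≡ R 0)
copy-input-runs R =
  runs-seq {Q1 = Assigned 1 0 R} (clear-runs (# 1) R) λ R₁ (c₁ , c₂) →
  runs-seq {Q1 = Transferred 0 1 R₁} (move-runs (# 0) (# 1) (λ ()) R₁) λ R₂ (_ , m₂ , _) →
  runs-seq {Q1 = Assigned 2 0 R₂} (clear-runs (# 2) R₂) λ R₃ (d₁ , d₂) →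
  runs-weaken (addto-runs (# 1) (# 2) (λ ()) (λ ()) (λ ()) R₃) λ R₄ (a₁ , a₂ , _) →
    let R₃1≡R0 = trans (d₂ 1 (λ ())) (trans m₂ (trans (cong (_+ R₁ 0) c₁) (c₂ 0 (λ ()))))
    in trans a₁ R₃1≡R0 , trans a₂ (cong₂ _+_ d₁ R₃1≡R0)

OUTPUT : Reg → Cmd
OUTPUT r = SEQ (CLEAR (# 0)) (MOVE r (# 0))

output-runs : ∀ {O} r → toℕ r ≢ 0 → ∀ R → Runs O (OUTPUT r) R (λ R' → R' 0 ≡ val R r)
output-runs r r≢0 R =
  runs-seq {Q1 = Assigned 0 0 R} (clear-runs (# 0) R) λ R₁ (c₁ , c₂) →
  runs-weaken (move-runs r (# 0) r≢0 R₁) λ R₂ (_ , m₂ , _) → trans m₂ (cong₂ _+_ c₁ (c₂ (toℕ r) r≢0))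

PUSH : Reg → Cmd
PUSH r = SEQ (PAIR r (# 3) (# 5)) (SEQ (CLEAR (# 3)) (MOVE (# 5) (# 3)))

push-runs : ∀ {O} r → toℕ r < 18 → toℕ r ≢ 5 → ∀ R →
  Runs O (PUSH r) R (λ R' → R' 3 ≡ pair (val R r) (R 3) × (∀ i → i ≢ 3 → i ≢ 5 → i ≢ 18 → i ≢ 19 → R' i ≡ R i))
push-runs r r<18 r≢5 R =
  runs-seq {Q1 = Paired (toℕ r) 3 5 R} (pair-runs r (# 3) (# 5) r<18 (from-yes (3 <? 18)) (from-yes (5 <? 18)) r≢5 R) λ R₁ (p₁ , p₂) →
  runs-seq {Q1 = Assigned 3 0 R₁} (clear-runs (# 3) R₁) λ R₂ (c₁ , c₂) →
  runs-weaken (move-runs (# 5) (# 3) (λ ()) R₂) λ R₃ (_ , m₂ , m₃) →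
    trans m₂ (cong₂ _+_ c₁ (trans (c₂ 5 (λ ())) p₁)) ,
    λ i i≢3 i≢5 i≢18 i≢19 → trans (m₃ i i≢5 i≢3) (trans (c₂ i i≢3) (p₂ i i≢5 i≢18 i≢19))

-- Packed lists

-- pack v c acc = ⟨v 0, ⟨v 1, … ⟨v (c ∸ 1), acc⟩ …⟩⟩
pack : (ℕ → ℕ) → ℕ → ℕ → ℕ
pack v zero acc = acc
pack v (suc c) acc = pack v c (pair (v c) acc)

dropEntries : ℕ → ℕ → ℕ
dropEntries zero y = y
dropEntries (suc c) y = dropEntries c (proj₂ (unpair y))

entry : ℕ → ℕ → ℕ
entry j y = proj₁ (unpair (dropEntries j y))

pack-suc : ∀ v c acc → pack v (suc c) acc ≡ pair (v 0) (pack (v ∘′ suc) c acc)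
pack-suc v zero acc = refl
pack-suc v (suc c) acc = pack-suc v c (pair (v (suc c)) acc)

entry-pack : ∀ j c v acc → j < c → entry j (pack v c acc) ≡ v j
entry-pack zero (suc c) v acc _
  rewrite pack-suc v c acc | unpair-pair (v 0) (pack (v ∘′ suc) c acc) = refl
entry-pack (suc j) (suc c) v acc (s≤s j<c)
  rewrite pack-suc v c acc | unpair-pair (v 0) (pack (v ∘′ suc) c acc) = entry-pack j c (v ∘′ suc) acc j<c

pack-mono-≤ : ∀ c {v w} → (∀ j → j < c → v j ≤ w j) → ∀ {acc acc'} → acc ≤ acc' → pack v c acc ≤ pack w c acc'
pack-mono-≤ zero v≤w acc≤acc' = acc≤acc'
pack-mono-≤ (suc c) v≤w acc≤acc' =
  pack-mono-≤ c (λ j j<c → v≤w j (m<n⇒m<1+n j<c)) (pair-mono-≤ (v≤w c ≤-refl) acc≤acc')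

pack-const-≤-suc : ∀ k n acc → pack (λ _ → k) n acc ≤ pack (λ _ → k) (suc n) acc
pack-const-≤-suc k n acc = pack-mono-≤ n (λ _ _ → ≤-refl) (n≤pair k acc)

pack-const-mono-≤ : ∀ k acc {m} n → m ≤ n → pack (λ _ → k) m acc ≤ pack (λ _ → k) n acc
pack-const-mono-≤ k acc zero z≤n = ≤-refl
pack-const-mono-≤ k acc (suc n) m≤1+n with m≤n⇒m<n∨m≡n m≤1+n
... | inj₂ refl = ≤-refl
... | inj₁ (s≤s m≤n) = ≤-trans (pack-const-mono-≤ k acc n m≤n) (pack-const-≤-suc k n acc)

-- Padded indices

encInstr : Instr → ℕ
encInstr (inc r) = pair 0 r
encInstr (dec r j) = pair 1 (pair r j)
encInstr (query r) = pair 2 r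

decodeInstr-encInstr : ∀ i → decodeInstr (encInstr i) ≡ i
decodeInstr-encInstr (inc r) rewrite unpair-pair 0 r = refl
decodeInstr-encInstr (dec r j) rewrite unpair-pair 1 (pair r j) | unpair-pair r j = refl
decodeInstr-encInstr (query r) rewrite unpair-pair 2 r = refl

-- The code of the program  dec (1 + ⟨n,j⟩) 1 ∷ decode j.  Its first instruction jumps to 1
-- whatever the (zero) contents of its register, so it only records n and j in the index.
paddedIndex : ℕ → ℕ → ℕ
paddedIndex n j = suc (pair (encInstr (dec (suc (pair n j)) 1)) j)

paddedIndex-mono-≤ : ∀ {n n' j j'} → n ≤ n' → j ≤ j' → paddedIndex n j ≤ paddedIndex n' j'
paddedIndex-mono-≤ n≤n' j≤j' =
  s≤s (pair-mono-≤ (pair-mono-≤ {1} ≤-refl (pair-mono-≤ {b = 1} (s≤s (pair-mono-≤ n≤n' j≤j')) ≤-refl)) j≤j')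

PADDED-INDEX : Cmd
PADDED-INDEX = SEQ (PAIR (# 1) (# 2) (# 6)) (SEQ (INC (# 6)) (SEQ (CLEAR (# 10)) (SEQ (INC (# 10))
       (SEQ (PAIR (# 6) (# 10) (# 7)) (SEQ (PAIR (# 10) (# 7) (# 8)) (SEQ (PAIR (# 8) (# 2) (# 9))
       (SEQ (CLEAR (# 4)) (SEQ (MOVE (# 9) (# 4)) (INC (# 4))))))))))

PaddedIndexed : Registers → Registers → Set
PaddedIndexed R R' = R' 4 ≡ paddedIndex (R 1) (R 2) × (∀ i → i < 4 → R' i ≡ R i)

<4⇒≢ : ∀ {i} k {4≤k : True (4 ≤? k)} → i < 4 → i ≢ k
<4⇒≢ k {4≤k} i<4 = <⇒≢ (<-≤-trans i<4 (toWitness 4≤k))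

padded-index-runs : ∀ {O} R → Runs O PADDED-INDEX R (PaddedIndexed R)
padded-index-runs {O} R =
  runs-seq {Q1 = Paired 1 2 6 R} (pair-runs (# 1) (# 2) (# 6) (from-yes (1 <? 18)) (from-yes (2 <? 18)) (from-yes (6 <? 18)) (λ ()) R) λ R1 (a1 , a2) →
  runs-seq {Q1 = Assigned 6 (suc (R1 6)) R1} (_ , eINC , assigned R1 (# 6) _) λ R2 (e2 , e2′) →
  runs-seq {Q1 = Assigned 10 0 R2} (clear-runs (# 10) R2) λ R3 (c1 , c2) →
  runs-seq {Q1 = Assigned 10 (suc (R3 10)) R3} (_ , eINC , assigned R3 (# 10) _) λ R4 (e4 , e4′) →
  runs-seq {Q1 = Paired 6 10 7 R4} (pair-runs (# 6) (# 10) (# 7) (from-yes (6 <? 18)) (from-yes (10 <? 18)) (from-yes (7 <? 18)) (λ ()) R4) λ R5 (b1 , b2) →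
  runs-seq {Q1 = Paired 10 7 8 R5} (pair-runs (# 10) (# 7) (# 8) (from-yes (10 <? 18)) (from-yes (7 <? 18)) (from-yes (8 <? 18)) (λ ()) R5) λ R6 (d1 , d2) →
  runs-seq {Q1 = Paired 8 2 9 R6} (pair-runs (# 8) (# 2) (# 9) (from-yes (8 <? 18)) (from-yes (2 <? 18)) (from-yes (9 <? 18)) (λ ()) R6) λ R7 (f1 , f2) →
  runs-seq {Q1 = Assigned 4 0 R7} (clear-runs (# 4) R7) λ R8 (g1 , g2) →
  runs-seq {Q1 = Transferred 9 4 R8} (move-runs (# 9) (# 4) (λ ()) R8) λ R9 (h1 , h2 , h3) →
  runs-weaken {Q1 = Assigned 4 (suc (R9 4)) R9} (_ , eINC , assigned R9 (# 4) _) λ R10 (e10 , e10′) →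
   let r1 : ∀ i → i < 4 → R1 i ≡ R i
       r1 i lt = a2 i (<4⇒≢ 6 lt) (<4⇒≢ 18 lt) (<4⇒≢ 19 lt)
       r2 : ∀ i → i < 4 → R2 i ≡ R i
       r2 i lt = trans (e2′ i (<4⇒≢ 6 lt)) (r1 i lt)
       r3 : ∀ i → i < 4 → R3 i ≡ R i
       r3 i lt = trans (c2 i (<4⇒≢ 10 lt)) (r2 i lt)
       r4 : ∀ i → i < 4 → R4 i ≡ R i
       r4 i lt = trans (e4′ i (<4⇒≢ 10 lt)) (r3 i lt)
       r5 : ∀ i → i < 4 → R5 i ≡ R i
       r5 i lt = trans (b2 i (<4⇒≢ 7 lt) (<4⇒≢ 18 lt) (<4⇒≢ 19 lt)) (r4 i lt)
       r6 : ∀ i → i < 4 → R6 i ≡ R i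
       r6 i lt = trans (d2 i (<4⇒≢ 8 lt) (<4⇒≢ 18 lt) (<4⇒≢ 19 lt)) (r5 i lt)
       r7 : ∀ i → i < 4 → R7 i ≡ R i
       r7 i lt = trans (f2 i (<4⇒≢ 9 lt) (<4⇒≢ 18 lt) (<4⇒≢ 19 lt)) (r6 i lt)
       v4x : R4 10 ≡ 1
       v4x = trans e4 (cong suc c1)
       v4y : R4 6 ≡ suc (pair (R 1) (R 2))
       v4y = trans (e4′ 6 (λ ())) (trans (c2 6 (λ ())) (trans e2 (cong suc a1)))
       v5x = trans b1 (cong₂ pair v4y v4x)
       v5y = trans (b2 10 (λ ()) (λ ()) (λ ())) v4x
       v6x = trans d1 (cong₂ pair v5y v5x)
       v7x = trans f1 (cong₂ pair v6x (r6 2 (from-yes (2 <? 4))))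
       v10 = trans e10 (cong suc (trans h2 (cong₂ _+_ g1 (trans (g2 9 (λ ())) v7x))))
   in v10 , λ i lt → trans (e10′ i (<4⇒≢ 4 lt))
        (trans (h3 i (<4⇒≢ 9 lt) (<4⇒≢ 4 lt)) (trans (g2 i (<4⇒≢ 4 lt)) (r7 i lt)))

pack-loop-runs : ∀ {O} body q w (v : ℕ → ℕ) → q ≢ 2 →
  (∀ R → R q ≡ w → Runs O body R (λ R' → R' q ≡ w × R' 2 ≡ R 2 × R' 3 ≡ pair (v (R 2)) (R 3))) →
  ∀ R → R q ≡ w → Runs O (LOOP (# 2) body) R (λ R' → R' 3 ≡ pack v (R 2) (R 3))
pack-loop-runs {O} body q w v q≢2 body-runs R Rq≡w = go (R 2) R refl Rq≡w
  where
  go : ∀ c R → R 2 ≡ c → R q ≡ w → Runs O (LOOP (# 2) body) R (λ R' → R' 3 ≡ pack v c (R 3))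
  go zero R R2≡0 _ = R , eL0 R2≡0 , refl
  go (suc c) R R2≡1+c Rq≡w =
    runs-loop-step {Q1 = λ R' → R' q ≡ w × R' 2 ≡ c × R' 3 ≡ pair (v c) (R 3)} R2≡1+c
      (runs-weaken (body-runs (upd R (# 2) c) (trans (update-≢ R 2 c q q≢2) Rq≡w)) λ R₁ (R₁q , R₁2 , R₁3) →
        R₁q , trans R₁2 (update-≡ R 2 c) , trans R₁3 (cong₂ pair (cong v (update-≡ R 2 c)) (update-≢ R 2 c 3 (λ ())))) λ R₁ (R₁q , R₁2 , R₁3) →
    runs-weaken (go c R₁ R₁2 R₁q) λ R' R'3 → trans R'3 (cong (pack v c) R₁3)

PACK-VALUE : Cmd
PACK-VALUE = SEQ PADDED-INDEX (SEQ (QRY (# 4)) (PUSH (# 4)))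

pack-value-runs : ∀ {O} n R → R 1 ≡ n →
  Runs O PACK-VALUE R (λ R' → R' 1 ≡ n × R' 2 ≡ R 2 × R' 3 ≡ pair (O (paddedIndex n (R 2))) (R 3))
pack-value-runs {O} n R R1≡n =
  runs-seq {Q1 = PaddedIndexed R} (padded-index-runs R) λ R₁ (k₁ , k₂) →
  runs-seq {Q1 = Assigned 4 (O (R₁ 4)) R₁} (_ , eQRY , assigned R₁ (# 4) _) λ R₂ (q₁ , q₂) →
  runs-weaken (push-runs (# 4) (from-yes (4 <? 18)) (λ ()) R₂) λ R₃ (p₁ , p₂) →
    trans (p₂ 1 (λ ()) (λ ()) (λ ()) (λ ())) (trans (q₂ 1 (λ ())) (trans (k₂ 1 (from-yes (1 <? 4))) R1≡n)) ,
    trans (p₂ 2 (λ ()) (λ ()) (λ ()) (λ ())) (trans (q₂ 2 (λ ())) (k₂ 2 (from-yes (2 <? 4)))) ,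
    trans p₁ (cong₂ pair (trans q₁ (cong O (trans k₁ (cong (λ m → paddedIndex m (R 2)) R1≡n))))
                         (trans (q₂ 3 (λ ())) (k₂ 3 (from-yes (3 <? 4)))))

packedValues : (ℕ → ℕ) → ℕ → ℕ
packedValues O n = pack (λ j → O (paddedIndex n j)) (suc n) 0

PACKED-VALUES : Cmd
PACKED-VALUES = SEQ COPY-INPUT (SEQ (INC (# 2)) (SEQ (CLEAR (# 3)) (SEQ (LOOP (# 2) PACK-VALUE) (OUTPUT (# 3)))))

packed-values-runs : ∀ {O} R → Runs O PACKED-VALUES R (λ R' → R' 0 ≡ packedValues O (R 0))
packed-values-runs {O} R =
  runs-seq {Q1 = λ R' → R' 1 ≡ R 0 × R' 2 ≡ R 0} (copy-input-runs R) λ R₁ (c₁ , c₂) →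
  runs-seq {Q1 = Assigned 2 (suc (R₁ 2)) R₁} (_ , eINC , assigned R₁ (# 2) _) λ R₂ (i₁ , i₂) →
  runs-seq {Q1 = Assigned 3 0 R₂} (clear-runs (# 3) R₂) λ R₃ (z₁ , z₂) →
  runs-seq {Q1 = λ R' → R' 3 ≡ pack v (R₃ 2) (R₃ 3)}
    (pack-loop-runs PACK-VALUE 1 (R 0) v (λ ()) (pack-value-runs (R 0)) R₃ (trans (z₂ 1 (λ ())) (trans (i₂ 1 (λ ())) c₁))) λ R₄ l₄ →
  runs-weaken (output-runs (# 3) (λ ()) R₄) λ R₅ o₅ →
    trans o₅ (trans l₄ (cong₂ (pack v) (trans (z₂ 2 (λ ())) (trans i₁ (cong suc c₂))) z₁))
  where
  v = λ j → O (paddedIndex (R 0) j)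

-- h in the theorem; starting the tuple from n makes it unbounded.
packedBound : (ℕ → ℕ) → ℕ → ℕ
packedBound g n = 2 + pack (λ _ → g (paddedIndex n n) ∸ 1) (suc n) n

PACKED-BOUND : Program → Cmd
PACKED-BOUND gp = SEQ COPY-INPUT (SEQ PADDED-INDEX (SEQ (CALL gp (# 4)) (SEQ (DEC (# 4)) (SEQ (INC (# 2))
  (SEQ (CLEAR (# 3)) (SEQ (ADDTO (# 1) (# 3)) (SEQ (LOOP (# 2) (PUSH (# 4))) (SEQ (OUTPUT (# 3)) (SEQ (INC (# 0)) (INC (# 0)))))))))))

push-copy-runs : ∀ {O} k R → R 4 ≡ k → Runs O (PUSH (# 4)) R (λ R' → R' 4 ≡ k × R' 2 ≡ R 2 × R' 3 ≡ pair k (R 3))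
push-copy-runs k R R4≡k =
  runs-weaken (push-runs (# 4) (from-yes (4 <? 18)) (λ ()) R) λ R' (p₁ , p₂) →
    trans (p₂ 4 (λ ()) (λ ()) (λ ()) (λ ())) R4≡k , p₂ 2 (λ ()) (λ ()) (λ ()) (λ ()) , trans p₁ (cong (λ w → pair w (R 3)) R4≡k)

packed-bound-runs : ∀ {O} gp g → (∀ x → Halts O gp x (g x)) → ∀ R → Runs O (PACKED-BOUND gp) R (λ R' → R' 0 ≡ packedBound g (R 0))
packed-bound-runs {O} gp g gp-computes-g R =
  runs-seq {Q1 = λ R' → R' 1 ≡ n × R' 2 ≡ n} (copy-input-runs R) λ R₁ (c₁ , c₂) →
  runs-seq {Q1 = PaddedIndexed R₁} (padded-index-runs R₁) λ R₂ (k₁ , k₂) →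
  runs-seq {Q1 = Assigned 4 (g (R₂ 4)) R₂} (_ , eCALL (gp-computes-g (R₂ 4)) , assigned R₂ (# 4) _) λ R₃ (g₁ , g₂) →
  runs-seq {Q1 = Assigned 4 (pred (R₃ 4)) R₃} (_ , eDEC , assigned R₃ (# 4) _) λ R₄ (d₁ , d₂) →
  runs-seq {Q1 = Assigned 2 (suc (R₄ 2)) R₄} (_ , eINC , assigned R₄ (# 2) _) λ R₅ (i₁ , i₂) →
  runs-seq {Q1 = Assigned 3 0 R₅} (clear-runs (# 3) R₅) λ R₆ (z₁ , z₂) →
  runs-seq {Q1 = AddedTo 1 3 R₆} (addto-runs (# 1) (# 3) (λ ()) (λ ()) (λ ()) R₆) λ R₇ (a₁ , a₂ , _ , a₄) →
  let R₄-low : ∀ i → i < 4 → R₄ i ≡ R₁ i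
      R₄-low i i<4 = trans (d₂ i (<4⇒≢ 4 i<4)) (trans (g₂ i (<4⇒≢ 4 i<4)) (k₂ i i<4))
      R₇4≡k = trans (a₄ 4 (λ ()) (λ ())) (trans (z₂ 4 (λ ())) (trans (i₂ 4 (λ ()))
                (trans d₁ (cong pred (trans g₁ (cong g (trans k₁ (cong₂ paddedIndex c₁ c₂))))))))
      R₇2≡1+n = trans (a₄ 2 (λ ()) (λ ())) (trans (z₂ 2 (λ ())) (trans i₁ (cong suc (trans (R₄-low 2 (from-yes (2 <? 4))) c₂))))
      R₇3≡n = trans a₂ (cong₂ _+_ z₁ (trans (z₂ 1 (λ ())) (trans (i₂ 1 (λ ())) (trans (R₄-low 1 (from-yes (1 <? 4))) c₁))))
  in
  runs-seq {Q1 = λ R' → R' 3 ≡ pack (λ _ → k) (R₇ 2) (R₇ 3)}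
    (pack-loop-runs (PUSH (# 4)) 4 k (λ _ → k) (λ ()) (push-copy-runs k) R₇ R₇4≡k) λ R₈ l₈ →
  runs-seq {Q1 = λ R' → R' 0 ≡ R₈ 3} (output-runs (# 3) (λ ()) R₈) λ R₉ o₉ →
  runs-seq {Q1 = Assigned 0 (suc (R₉ 0)) R₉} (_ , eINC , assigned R₉ (# 0) _) λ R₁₀ (j₁ , _) →
  runs-weaken {Q1 = Assigned 0 (suc (R₁₀ 0)) R₁₀} (_ , eINC , assigned R₁₀ (# 0) _) λ R₁₁ (j₂ , _) →
    trans j₂ (cong suc (trans j₁ (cong suc (trans o₉ (trans l₈ (cong₂ (pack (λ _ → k)) R₇2≡1+n R₇3≡n))))))
  where
  n = R 0
  k = g (paddedIndex n n) ∸ 1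

DECODE-PADDED : Cmd
DECODE-PADDED = SEQ COPY-INPUT (SEQ (DEC (# 1)) (SEQ (UNPAIR (# 1) (# 2) (# 3)) (SEQ (UNPAIR (# 2) (# 4) (# 5))
  (SEQ (UNPAIR (# 5) (# 6) (# 7)) (SEQ (DEC (# 6)) (UNPAIR (# 6) (# 8) (# 9)))))))

decode-padded-runs : ∀ {O} n j R → R 0 ≡ paddedIndex n j → Runs O DECODE-PADDED R (λ R' → R' 8 ≡ n × R' 9 ≡ j)
decode-padded-runs n j R R0≡nj =
  runs-seq {Q1 = λ R' → R' 1 ≡ R 0 × R' 2 ≡ R 0} (copy-input-runs R) λ R₁ (c₁ , _) →
  runs-seq {Q1 = Assigned 1 (pred (R₁ 1)) R₁} (_ , eDEC , assigned R₁ (# 1) _) λ R₂ (d₁ , _) →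
  runs-seq {Q1 = Unpaired 1 2 3 R₂} (unpair-runs (# 1) (# 2) (# 3) (from-yes (1 <? 16)) (from-yes (2 <? 16)) (from-yes (3 <? 16)) (λ ()) (λ ()) (λ ()) R₂) λ R₃ (u₁ , _) →
  runs-seq {Q1 = Unpaired 2 4 5 R₃} (unpair-runs (# 2) (# 4) (# 5) (from-yes (2 <? 16)) (from-yes (4 <? 16)) (from-yes (5 <? 16)) (λ ()) (λ ()) (λ ()) R₃) λ R₄ (_ , v₂ , _) →
  runs-seq {Q1 = Unpaired 5 6 7 R₄} (unpair-runs (# 5) (# 6) (# 7) (from-yes (5 <? 16)) (from-yes (6 <? 16)) (from-yes (7 <? 16)) (λ ()) (λ ()) (λ ()) R₄) λ R₅ (w₁ , _) →
  runs-seq {Q1 = Assigned 6 (pred (R₅ 6)) R₅} (_ , eDEC , assigned R₅ (# 6) _) λ R₆ (e₁ , _) →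
  runs-weaken (unpair-runs (# 6) (# 8) (# 9) (from-yes (6 <? 16)) (from-yes (8 <? 16)) (from-yes (9 <? 16)) (λ ()) (λ ()) (λ ()) R₆) λ R₇ (x₁ , x₂ , _) →
    let R₂1 = trans d₁ (cong pred (trans c₁ R0≡nj))
        R₃2 = trans u₁ (trans (cong (proj₁ ∘′ unpair) R₂1) (cong proj₁ (unpair-pair (pair 1 C) j)))
        R₄5 = trans v₂ (trans (cong (proj₂ ∘′ unpair) R₃2) (cong proj₂ (unpair-pair 1 C)))
        R₆6 = trans e₁ (cong pred (trans w₁ (trans (cong (proj₁ ∘′ unpair) R₄5) (cong proj₁ (unpair-pair (suc (pair n j)) 1)))))
    in trans x₁ (trans (cong (proj₁ ∘′ unpair) R₆6) (cong proj₁ (unpair-pair n j))) ,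
       trans x₂ (trans (cong (proj₂ ∘′ unpair) R₆6) (cong proj₂ (unpair-pair n j)))
  where
  C = pair (suc (pair n j)) 1

DROP-ENTRY : Cmd
DROP-ENTRY = SEQ (UNPAIR (# 8) (# 10) (# 11)) (SEQ (CLEAR (# 8)) (MOVE (# 11) (# 8)))

drop-entry-runs : ∀ {O} R → Runs O DROP-ENTRY R (λ R' → R' 8 ≡ proj₂ (unpair (R 8)) × R' 9 ≡ R 9)
drop-entry-runs R =
  runs-seq {Q1 = Unpaired 8 10 11 R} (unpair-runs (# 8) (# 10) (# 11) (from-yes (8 <? 16)) (from-yes (10 <? 16)) (from-yes (11 <? 16)) (λ ()) (λ ()) (λ ()) R) λ R₁ (_ , u₂ , u₃) →
  runs-seq {Q1 = Assigned 8 0 R₁} (clear-runs (# 8) R₁) λ R₂ (c₁ , c₂) →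
  runs-weaken (move-runs (# 11) (# 8) (λ ()) R₂) λ R₃ (_ , m₂ , m₃) →
    trans m₂ (cong₂ _+_ c₁ (trans (c₂ 11 (λ ())) u₂)) ,
    trans (m₃ 9 (λ ()) (λ ())) (trans (c₂ 9 (λ ())) (u₃ 9 (λ ()) (λ ()) (λ ()) (λ ()) (λ ())))

drop-entries-runs : ∀ {O} j R → R 9 ≡ j → Runs O (LOOP (# 9) DROP-ENTRY) R (λ R' → R' 8 ≡ dropEntries j (R 8))
drop-entries-runs zero R R9≡0 = R , eL0 R9≡0 , refl
drop-entries-runs (suc j) R R9≡1+j =
  runs-loop-step {Q1 = λ R' → R' 8 ≡ proj₂ (unpair (upd R (# 9) j 8)) × R' 9 ≡ upd R (# 9) j 9} R9≡1+j
    (drop-entry-runs (upd R (# 9) j)) λ R₁ (R₁8 , R₁9) →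
  runs-weaken (drop-entries-runs j R₁ (trans R₁9 (update-≡ R 9 j))) λ R' R'8 →
    trans R'8 (cong (dropEntries j) (trans R₁8 (cong (proj₂ ∘′ unpair) (update-≢ R 9 j 8 (λ ())))))

ENTRY-OF : Program → Cmd
ENTRY-OF ep = SEQ DECODE-PADDED (SEQ (CALL ep (# 8)) (SEQ (LOOP (# 9) DROP-ENTRY) (SEQ (UNPAIR (# 8) (# 10) (# 11)) (OUTPUT (# 10)))))

entry-of-runs : ∀ {O} ep n j y → Halts O ep n y → ∀ R → R 0 ≡ paddedIndex n j → Runs O (ENTRY-OF ep) R (λ R' → R' 0 ≡ entry j y)
entry-of-runs ep n j y halts R R0≡nj =
  runs-seq {Q1 = λ R' → R' 8 ≡ n × R' 9 ≡ j} (decode-padded-runs n j R R0≡nj) λ R₁ (R₁8 , R₁9) →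
  runs-seq {Q1 = Assigned 8 y R₁} (_ , eCALL (subst (λ x → Halts _ ep x y) (sym R₁8) halts) , assigned R₁ (# 8) y) λ R₂ (c₁ , c₂) →
  runs-seq {Q1 = λ R' → R' 8 ≡ dropEntries j (R₂ 8)} (drop-entries-runs j R₂ (trans (c₂ 9 (λ ())) R₁9)) λ R₃ l₃ →
  runs-seq {Q1 = Unpaired 8 10 11 R₃} (unpair-runs (# 8) (# 10) (# 11) (from-yes (8 <? 16)) (from-yes (10 <? 16)) (from-yes (11 <? 16)) (λ ()) (λ ()) (λ ()) R₃) λ R₄ (u₁ , _) →
  runs-weaken (output-runs (# 10) (λ ()) R₄) λ R₅ o₅ →
    trans o₅ (trans u₁ (cong (proj₁ ∘′ unpair) (trans l₃ (cong (dropEntries j) c₁))))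

decodeF-fuel : ∀ f₁ f₂ m → m ≤ f₁ → m ≤ f₂ → decodeF f₁ m ≡ decodeF f₂ m
decodeF-fuel zero zero zero _ _ = refl
decodeF-fuel zero (suc f₂) zero _ _ = refl
decodeF-fuel (suc f₁) zero zero _ _ = refl
decodeF-fuel (suc f₁) (suc f₂) zero _ _ = refl
decodeF-fuel (suc f₁) (suc f₂) (suc m) (s≤s m≤f₁) (s≤s m≤f₂) =
  cong (decodeInstr (proj₁ (unpair m)) ∷_)
    (decodeF-fuel f₁ f₂ (proj₂ (unpair m)) (≤-trans (proj₂ (unpair-≤ m)) m≤f₁) (≤-trans (proj₂ (unpair-≤ m)) m≤f₂))

decode-suc-pair : ∀ i b → decode (suc (pair (encInstr i) b)) ≡ i ∷ decode b
decode-suc-pair i b rewrite unpair-pair (encInstr i) b =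
  cong₂ _∷_ (decodeInstr-encInstr i) (decodeF-fuel _ b b (n≤pair (encInstr i) b) ≤-refl)

-- Opaque, so that the codes of the concrete programs below are never normalised.
opaque
  code : Program → ℕ
  code [] = 0
  code (i ∷ p) = suc (pair (encInstr i) (code p))

  decode-code : ∀ p → decode (code p) ≡ p
  decode-code [] = refl
  decode-code (i ∷ p) = trans (decode-suc-pair i (code p)) (cong (i ∷_) (decode-code p))

halts-compile : ∀ {O} c x {R'} → Exec O c (regs (initial x)) R' → Halts O (compile 0 c) x (R' 0)
halts-compile {O} c x ex with compile-correct ex (compile 0 c) 0 (regs (initial x)) (λ i eq → eq) (represents (λ i → refl) refl)
... | t , pc≡size , rep = t , subst (_≤ pc (run O (compile 0 c) t (initial x))) (sym (length-compile 0 c)) (≤-reflexive (sym pc≡size)) , agree rep (# 0)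

-- Behind the padding instruction the code sits at address 1, hence compile 1.
halts-padded : ∀ {O} c x m {R'} → Exec O c (regs (initial x)) R' → Halts O (dec (suc m) 1 ∷ compile 1 c) x (R' 0)
halts-padded {O} c x m {R'} ex
  with reach-dec-zero {Q = Represents R'} (suc m) 1 refl refl
         (compile-correct ex P 1 (regs (initial x)) (embeds-∷ P 0 _ _ (λ i eq → eq)) (represents (λ i → refl) refl))
  where P = dec (suc m) 1 ∷ compile 1 c
... | t , pc≡size , rep = t , subst (_≤ pc (run O (dec (suc m) 1 ∷ compile 1 c) t (initial x))) (cong suc (sym (length-compile 1 c))) (≤-reflexive (sym pc≡size)) , agree rep (# 0)

index : Cmd → ℕ
index c = code (compile 0 c)

conv-index : ∀ {O} c x y → Runs O c (regs (initial x)) (λ R' → R' 0 ≡ y) → Conv O (index c) x y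
conv-index {O} c x y (R' , ex , R'0≡y) =
  subst (λ p → Halts O p x y) (sym (decode-code (compile 0 c))) (subst (Halts O (compile 0 c) x) R'0≡y (halts-compile c x ex))

conv-paddedIndex : ∀ {O} c n x y → Runs O c (regs (initial x)) (λ R' → R' 0 ≡ y) → Conv O (paddedIndex n (code (compile 1 c))) x y
conv-paddedIndex {O} c n x y (R' , ex , R'0≡y) =
  subst (λ p → Halts O p x y)
    (sym (trans (decode-suc-pair (dec (suc (pair n b)) 1) b) (cong (dec (suc (pair n b)) 1 ∷_) (decode-code (compile 1 c)))))
    (subst (Halts O (dec (suc (pair n b)) 1 ∷ compile 1 c) x) R'0≡y (halts-padded c x (pair n b) ex))
  where b = code (compile 1 c)

packedBound-order : ∀ g → OrderFunction g → OrderFunction (packedBound g)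
packedBound-order g ((eg , eg-computes-g) , g-mono , _ , _) = recursive , monotone , unbounded , s≤s (s≤s z≤n)
  where
  recursive : Recursive (packedBound g)
  recursive = index (PACKED-BOUND (decode eg)) , λ n →
    conv-index (PACKED-BOUND (decode eg)) n (packedBound g n) (packed-bound-runs (decode eg) g eg-computes-g (regs (initial n)))
  monotone : ∀ m n → m ≤ n → packedBound g m ≤ packedBound g n
  monotone m n m≤n = s≤s (s≤s (≤-trans
    (pack-mono-≤ (suc m) (λ _ _ → ∸-monoˡ-≤ 1 (g-mono _ _ (paddedIndex-mono-≤ m≤n m≤n))) m≤n)
    (pack-const-mono-≤ _ n (suc n) (s≤s m≤n))))
  unbounded : ∀ k → Σ ℕ λ n → k ≤ packedBound g n
  unbounded k = k , ≤-trans (pack-const-mono-≤ _ k (suc k) z≤n) (m≤n+m _ 2)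

packedValues-computable : ∀ f → Computes f (packedValues f)
packedValues-computable f = index PACKED-VALUES , λ n → conv-index PACKED-VALUES n _ (packed-values-runs (regs (initial n)))

packedValues-bounded : ∀ g f → (∀ m n → m ≤ n → g m ≤ g n) → BoundedBy g f → BoundedBy (packedBound g) (packedValues f)
packedValues-bounded g f g-mono f<g n = s≤s (≤-trans (pack-mono-≤ (suc n) value≤bound z≤n) (n≤1+n _))
  where
  value≤bound : ∀ j → j < suc n → f (paddedIndex n j) ≤ g (paddedIndex n n) ∸ 1
  value≤bound j j<1+n = ∸-monoˡ-≤ 1 (≤-trans (f<g (paddedIndex n j)) (g-mono _ _ (paddedIndex-mono-≤ {n} {n} ≤-refl (s≤s⁻¹ j<1+n))))

entryIndex : ℕ → ℕ
entryIndex e = code (compile 1 (ENTRY-OF (decode e)))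

φ-paddedIndex-entryIndex : ∀ e n y → φ e n y →
  let b = entryIndex e in φ (paddedIndex n b) (paddedIndex n b) (entry b y)
φ-paddedIndex-entryIndex e n y φeny =
  conv-paddedIndex (ENTRY-OF (decode e)) n x (entry b y) (entry-of-runs (decode e) n b y φeny (regs (initial x)) refl)
  where
  b = entryIndex e
  x = paddedIndex n b

packedValues-SNPR : ∀ f → DNR f → SNPR (packedValues f)
packedValues-SNPR f f-dnr e = b , λ n b≤n y φeny F≡y →
  f-dnr (paddedIndex n b) (entry b y) (φ-paddedIndex-entryIndex e n y φeny)
    (trans (sym (entry-pack b (suc n) (λ j → f (paddedIndex n j)) 0 (s≤s b≤n))) (cong (entry b) F≡y))
  where
  b = entryIndex e

theorem3 : (g : ℕ → ℕ) → OrderFunction g →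
    Σ (ℕ → ℕ) λ h → OrderFunction h ×
      ((f : ℕ → ℕ) → DNRb g f → Σ (ℕ → ℕ) λ F → Computes f F × SNPRb h F)
theorem3 g g-order@(_ , g-mono , _) =
  packedBound g , packedBound-order g g-order , λ f (f-dnr , f<g) →
    packedValues f , packedValues-computable f , packedValues-SNPR f f-dnr , packedValues-bounded g f g-mono f<g
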